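{- Let $m$ be a positive integer and let $P$ be a $V(C)$-path in $G-D$ with endpoints $x$ and $y$. If $P$ has length at most $m+2$, then $\mathrm{dist}_C(x,y)\le 4m-1$.
   Context: Graphs are finite and simple. A hole is an induced cycle of length at least $4$; a graph is chordal if it has no hole. Let $s_k=4k(\log k+\log\log k+4)$ for $k\ge2$, $s_1=2$, and $\mu_k=76s_{k+1}+3217k+1985$. Standing assumptions: $G$ is a graph, $k$ a positive integer, $C$ a shortest hole of $G$ of length strictly greater than $\mu_k$, and $G-V(C)$ is chordal. $D$ is the set of vertices of $G$ adjacent to every vertex of $C$. For a vertex set $S$, an $S$-path is a path connecting two distinct vertices of $S$ all of whose internal vertices (possibly none) lie outside $S$. $\mathrm{dist}_C$ denotes distance in the cycle $C$. -}

module Defs where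

open import Data.Nat using (ℕ; zero; suc; _+_; _*_; _∸_; _≤_; _<_; _⊓_; ∣_-_∣)
open import Data.Fin using (Fin; toℕ; fromℕ; inject₁) renaming (zero to fzero; suc to fsuc)
open import Data.Bool using (Bool; T)
open import Data.Integer using (ℤ; +_) renaming (_-_ to _-ℤ_)
open import Data.Rational using (ℚ; 0ℚ; 1ℚ) renaming (_+_ to _+ℚ_; _*_ to _*ℚ_; _-_ to _-ℚ_; _/_ to _/ℚ_; _≤_ to _≤ℚ_; _<_ to _<ℚ_)
open import Data.Product using (Σ; _×_; ∃)
open import Relation.Nullary using (¬_)
open import Relation.Binary.PropositionalEquality using (_≡_; _≢_)
open import Function.Definitions using (Injective)

distC : (L : ℕ) → Fin L → Fin L → ℕ
distC L i j = ∣ toℕ i - toℕ j ∣ ⊓ (L ∸ ∣ toℕ i - toℕ j ∣)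

record Graph : Set where
  field
    n     : ℕ
    adj   : Fin n → Fin n → Bool
    sym   : ∀ u v → adj u v ≡ adj v u
    irref : ∀ u → ¬ T (adj u u)

module _ (G : Graph) where
  open Graph G

  E : Fin n → Fin n → Set
  E u v = T (adj u v)

  IsHole : (L : ℕ) → (Fin L → Fin n) → Set
  IsHole L c = (4 ≤ L) × Injective _≡_ _≡_ c
             × (∀ i j → (E (c i) (c j) → distC L i j ≡ 1) × (distC L i j ≡ 1 → E (c i) (c j)))

  IsShortestHole : (L : ℕ) → (Fin L → Fin n) → Set
  IsShortestHole L c = IsHole L c × (∀ L' (c' : Fin L' → Fin n) → IsHole L' c' → L ≤ L')

  InCycle : (L : ℕ) → (Fin L → Fin n) → Fin n → Set
  InCycle L c v = Σ (Fin L) λ i → c i ≡ v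

  InD : (L : ℕ) → (Fin L → Fin n) → Fin n → Set
  InD L c v = ∀ i → E v (c i)

  -- G - V(C) is chordal: G has no hole all of whose vertices lie outside V(C)
  -- (the holes of the induced subgraph G - V(C) are exactly these)
  ChordalMinusCycle : (L : ℕ) → (Fin L → Fin n) → Set
  ChordalMinusCycle L c =
    ¬ (Σ ℕ λ L' → Σ (Fin L' → Fin n) λ h → IsHole L' h × (∀ i → ¬ InCycle L c (h i)))

  IsPath : (ℓ : ℕ) → (Fin (suc ℓ) → Fin n) → Set
  IsPath ℓ p = Injective _≡_ _≡_ p × (∀ (i : Fin ℓ) → E (p (inject₁ i)) (p (fsuc i)))

  IsVCPathInGminusD : (L : ℕ) → (Fin L → Fin n) → (ℓ : ℕ) → (Fin (suc ℓ) → Fin n) → Set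
  IsVCPathInGminusD L c ℓ p =
    IsPath ℓ p
    × p fzero ≢ p (fromℕ ℓ)
    × InCycle L c (p fzero) × InCycle L c (p (fromℕ ℓ))
    × (∀ i → toℕ i ≢ 0 → toℕ i ≢ ℓ → ¬ InCycle L c (p i))
    × (∀ i → ¬ InD L c (p i))

-- The real-valued threshold μ_k, encoded with rationals and exp partial sums.

expTerm : ℚ → ℕ → ℚ
expTerm q zero    = 1ℚ
expTerm q (suc i) = (expTerm q i *ℚ q) *ℚ ((+ 1) /ℚ suc i)

expPartial : ℚ → ℕ → ℚ
expPartial q zero    = 0ℚ
expPartial q (suc N) = expPartial q N +ℚ expTerm q N

-- t(L) = (L - 3217k - 1985) / (304 (k+1)) - 4, so that (with natural logarithms)
-- L > μ_k = 76 s_{k+1} + 3217k + 1985  iff  t(L) > ln(k+1) + ln ln(k+1)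
--                                       iff  exp(t(L)) > (k+1) ln(k+1).
muT : ℕ → ℕ → ℚ
muT k L = (((+ L) -ℤ (+ (3217 * k + 1985))) /ℚ suc (303 + 304 * k)) -ℚ ((+ 4) /ℚ 1)

-- L > μ_k, for k ≥ 1 (so k+1 ≥ 2 and s_{k+1} = 4(k+1)(ln(k+1) + ln ln(k+1) + 4)).
-- Equivalent to: there are rationals 0 ≤ q < t(L) and r ≥ 0 with r ≤ exp q and
-- exp (r/(k+1)) > k+1.
GreaterThanMu : ℕ → ℕ → Set
GreaterThanMu k L =
  Σ ℚ λ q → Σ ℚ λ r →
    (0ℚ ≤ℚ q) × (q <ℚ muT k L) × (0ℚ ≤ℚ r)
    × (Σ ℕ λ N → r ≤ℚ expPartial q N)
    × (Σ ℕ λ M → ((+ suc k) /ℚ 1) <ℚ expPartial (r *ℚ ((+ 1) /ℚ suc k)) M)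

-- We may assume 2ℓ < L, since otherwise dist_C(x, y) ≤ L/2 ≤ ℓ ≤ m + 2 ≤ 4m − 1.
-- By strong induction on ℓ, a V(C)-path q₀ … q_ℓ in G − D satisfies dist_C(q₀, q_ℓ) ≤ ℓ for ℓ ≤ 2
-- and ≤ 4ℓ − 9 for ℓ ≥ 3, which is 4m − 1 at ℓ = m + 2.  A chord of the path yields a shorter
-- V(C)-path.  If the path is induced and some q_i with 2 ≤ i ≤ ℓ − 2 has a neighbour e on C,
-- cutting the path at e gives two shorter V(C)-paths, and the triangle inequality for dist_C
-- concludes.  Otherwise only q₁ and q_{ℓ−1} see C, and everything rests on the minimality of C:
-- an arc of C closed up by an induced path outside C without further edges to the arc is a hole,
-- hence has length at least L.  For a single vertex outside C ∪ D this says that its neighbours on C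
-- lie within distance 2 of each other.  For the arc of length d = dist_C(q₀, q_ℓ) and the path it
-- gives a common neighbour of q₁ and q_{ℓ−1} on that arc, whence d ≤ 2 + 2 when ℓ ≥ 4; when ℓ = 3
-- the same argument on the complementary arc gives d ≤ 3.

module Submission where

open import Defs
open import Data.Nat using (ℕ; suc; _*_; _∸_; _+_; _≤_; _<_)
open import Data.Fin using (Fin; fromℕ) renaming (zero to fzero)
open import Relation.Binary.PropositionalEquality using (_≡_)

open import Data.Nat
open import Data.Nat.Properties
open import Data.Nat.DivMod
open import Data.Nat.Induction using (<-rec)
open import Data.Nat.Tactic.RingSolver using (solve-∀)
open import Data.Fin using (toℕ; fromℕ<)
open import Data.Fin.Properties using (toℕ<n; toℕ-injective; toℕ-fromℕ<; toℕ-fromℕ; toℕ-inject₁; any?; ¬∀⟶∃¬)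
open import Data.Bool using (T)
open import Data.Product using (Σ; _×_; _,_; proj₁; proj₂)
open import Data.Sum using (_⊎_; inj₁; inj₂)
open import Data.Empty using (⊥-elim)
open import Function using (_∘_)
open import Relation.Nullary using (¬_; Dec; yes; no)
open import Relation.Nullary.Decidable using (_×-dec_; T?)
open import Relation.Unary using (Decidable)
open import Relation.Binary.Definitions using (tri<; tri≈; tri>)
open import Relation.Binary.PropositionalEquality

-- Distance on a cycle of length L

cycNorm : ℕ → ℕ → ℕ
cycNorm L δ = δ ⊓ (L ∸ δ)

cycDist : ℕ → ℕ → ℕ → ℕ
cycDist L x y = cycNorm L ∣ x - y ∣

cycNorm≤ : ∀ L δ → cycNorm L δ ≤ δ
cycNorm≤ L δ = m⊓n≤m δ (L ∸ δ)

cycNorm≤∸ : ∀ L δ → cycNorm L δ ≤ L ∸ δ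
cycNorm≤∸ L δ = m⊓n≤n δ (L ∸ δ)

cycNorm-∸ : ∀ L δ → δ ≤ L → cycNorm L (L ∸ δ) ≡ cycNorm L δ
cycNorm-∸ L δ δ≤L = trans (cong ((L ∸ δ) ⊓_) (m∸[m∸n]≡n δ≤L)) (⊓-comm (L ∸ δ) δ)

cycNorm≡1 : ∀ L δ → cycNorm L δ ≡ 1 → δ ≡ 1 ⊎ L ∸ δ ≡ 1
cycNorm≡1 L δ eq with ⊓-sel δ (L ∸ δ)
... | inj₁ δ⊓≡δ = inj₁ (trans (sym δ⊓≡δ) eq)
... | inj₂ δ⊓≡L∸δ = inj₂ (trans (sym δ⊓≡L∸δ) eq)

cycNorm-pos : ∀ L δ → 0 < δ → δ < L → 0 < cycNorm L δ
cycNorm-pos L δ 0<δ δ<L = ⊓-glb 0<δ (m<n⇒0<n∸m δ<L)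

cycDist-comm : ∀ L x y → cycDist L x y ≡ cycDist L y x
cycDist-comm L x y = cong (cycNorm L) (∣-∣-comm x y)

cycDist-refl : ∀ L x → cycDist L x x ≡ 0
cycDist-refl L x = cong (cycNorm L) (∣n-n∣≡0 x)

cycDist-+ʳ : ∀ L x δ → cycDist L x (x + δ) ≡ cycNorm L δ
cycDist-+ʳ L x δ = cong (cycNorm L) (∣m-m+n∣≡n x δ)

cycDist-+ˡ : ∀ L x δ → cycDist L (x + δ) x ≡ cycNorm L δ
cycDist-+ˡ L x δ = trans (cycDist-comm L (x + δ) x) (cycDist-+ʳ L x δ)

cycDist-half : ∀ L x y → x ≤ L → y ≤ L → 2 * cycDist L x y ≤ L
cycDist-half L x y x≤L y≤L = begin
  D + (D + 0)          ≤⟨ +-mono-≤ (cycNorm≤ L δ) (≤-trans (≤-reflexive (+-identityʳ D)) (cycNorm≤∸ L δ)) ⟩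
  δ + (L ∸ δ)          ≡⟨ m+[n∸m]≡n (≤-trans (∣m-n∣≤m⊔n x y) (⊔-lub x≤L y≤L)) ⟩
  L                    ∎
  where
  open ≤-Reasoning
  δ = ∣ x - y ∣
  D = cycDist L x y

module _ (L : ℕ) .{{_ : NonZero L}} where

  cycDist-+-mod : ∀ i δ → i < L → δ < L → cycDist L i ((i + δ) % L) ≡ cycNorm L δ
  cycDist-+-mod i δ i<L δ<L with i + δ <? L
  ... | yes i+δ<L = trans (cong (cycDist L i) (m<n⇒m%n≡m i+δ<L)) (cycDist-+ʳ L i δ)
  ... | no i+δ≮L with m≤n⇒∃[o]m+o≡n (≮⇒≥ i+δ≮L)
  ...   | r , L+r≡i+δ = begin
    cycDist L i ((i + δ) % L)      ≡⟨ cong (λ j → cycDist L i (j % L)) (trans (sym L+r≡i+δ) (+-comm L r)) ⟩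
    cycDist L i ((r + L) % L)      ≡⟨ cong (cycDist L i) (trans ([m+n]%n≡m%n r L) (m<n⇒m%n≡m r<L)) ⟩
    cycDist L i r                  ≡⟨ cong (λ j → cycDist L j r) i≡r+[L∸δ] ⟩
    cycDist L (r + (L ∸ δ)) r      ≡⟨ cycDist-+ˡ L r (L ∸ δ) ⟩
    cycNorm L (L ∸ δ)              ≡⟨ cycNorm-∸ L δ (<⇒≤ δ<L) ⟩
    cycNorm L δ                    ∎
    where
    open ≡-Reasoning
    r<L : r < L
    r<L = +-cancelˡ-< L r L (subst (_< L + L) (sym L+r≡i+δ) (+-mono-< i<L δ<L))
    i≡r+[L∸δ] : i ≡ r + (L ∸ δ)
    i≡r+[L∸δ] = +-cancelʳ-≡ δ i (r + (L ∸ δ)) (begin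
      i + δ               ≡⟨ sym L+r≡i+δ ⟩
      L + r               ≡⟨ +-comm L r ⟩
      r + L               ≡⟨ cong (r +_) (sym (m∸n+n≡m (<⇒≤ δ<L))) ⟩
      r + (L ∸ δ + δ)     ≡⟨ sym (+-assoc r (L ∸ δ) δ) ⟩
      r + (L ∸ δ) + δ     ∎)

  cycDist-mod : ∀ t δ → δ < L → cycDist L (t % L) ((t + δ) % L) ≡ cycNorm L δ
  cycDist-mod t δ δ<L = begin
    cycDist L (t % L) ((t + δ) % L)          ≡⟨ cong (cycDist L (t % L)) (%-distribˡ-+ t δ L) ⟩
    cycDist L (t % L) ((t % L + δ % L) % L)  ≡⟨ cong (λ j → cycDist L (t % L) ((t % L + j) % L)) (m<n⇒m%n≡m δ<L) ⟩
    cycDist L (t % L) ((t % L + δ) % L)      ≡⟨ cycDist-+-mod (t % L) δ (m%n<n t L) δ<L ⟩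
    cycNorm L δ                              ∎
    where open ≡-Reasoning

+-swapʳ : ∀ x y z → x + y + z ≡ x + z + y
+-swapʳ = solve-∀

≤⊓+⊓ : ∀ {n} a b c d → n ≤ a + c → n ≤ a + d → n ≤ b + c → n ≤ b + d → n ≤ a ⊓ b + c ⊓ d
≤⊓+⊓ a b c d n≤a+c n≤a+d n≤b+c n≤b+d =
  subst (_ ≤_) (sym (trans (+-distribʳ-⊓ (c ⊓ d) a b) (cong₂ _⊓_ (+-distribˡ-⊓ a c d) (+-distribˡ-⊓ b c d))))
    (⊓-glb (⊓-glb n≤a+c n≤a+d) (⊓-glb n≤b+c n≤b+d))

cycNorm-subadditive : ∀ L p q → p + q < L → cycNorm L (p + q) ≤ cycNorm L p + cycNorm L q
cycNorm-subadditive L p q p+q<L = ≤⊓+⊓ p (L ∸ p) q (L ∸ q)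
  (cycNorm≤ L (p + q))
  (≤-trans (cycNorm≤∸ L (p + q)) (≤-trans (∸-monoʳ-≤ L (m≤n+m q p)) (m≤n+m (L ∸ q) p)))
  (≤-trans (cycNorm≤∸ L (p + q)) (≤-trans (∸-monoʳ-≤ L (m≤m+n p q)) (m≤m+n (L ∸ p) q)))
  (≤-trans (cycNorm≤ L (p + q)) (subst (_≤ (L ∸ p) + (L ∸ q)) (+-comm q p)
     (+-mono-≤ (m+n≤o⇒m≤o∸n q (subst (_≤ L) (+-comm p q) (<⇒≤ p+q<L))) (m+n≤o⇒m≤o∸n p (<⇒≤ p+q<L)))))

+-[∸+] : ∀ L p q → p + q ≤ L → p + (L ∸ (p + q)) ≡ L ∸ q
+-[∸+] L p q p+q≤L = trans (sym (+-∸-assoc p p+q≤L)) ([m+n]∸[m+o]≡n∸o p L q)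

-- q is the difference of p + q and p, read backwards around the cycle.
cycNorm-∸-subadditive : ∀ L p q → p + q < L → cycNorm L q ≤ cycNorm L p + cycNorm L (p + q)
cycNorm-∸-subadditive L p zero    _      = z≤n
cycNorm-∸-subadditive L p (suc q) p+q<L = begin
  cycNorm L (suc q)                          ≡⟨ sym (cycNorm-∸ L (suc q) q<L) ⟩
  cycNorm L (L ∸ suc q)                      ≡⟨ cong (cycNorm L) (sym (+-[∸+] L p (suc q) (<⇒≤ p+q<L))) ⟩
  cycNorm L (p + (L ∸ (p + suc q)))          ≤⟨ cycNorm-subadditive L p _ p+[L∸[p+q]]<L ⟩
  cycNorm L p + cycNorm L (L ∸ (p + suc q))  ≡⟨ cong (cycNorm L p +_) (cycNorm-∸ L (p + suc q) (<⇒≤ p+q<L)) ⟩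
  cycNorm L p + cycNorm L (p + suc q)        ∎
  where
  open ≤-Reasoning
  q<L : suc q ≤ L
  q<L = ≤-trans (m≤n+m (suc q) p) (<⇒≤ p+q<L)
  p+[L∸[p+q]]<L : p + (L ∸ (p + suc q)) < L
  p+[L∸[p+q]]<L = subst (_< L) (sym (+-[∸+] L p (suc q) (<⇒≤ p+q<L))) (∸-monoʳ-< z<s q<L)

cycDist-triangle-≤ : ∀ L x y z → x ≤ z → y < L → z < L → cycDist L x z ≤ cycDist L x y + cycDist L y z
cycDist-triangle-≤ L x y z x≤z y<L z<L with ≤-total y x | ≤-total y z
... | inj₁ y≤x | _ with m≤n⇒∃[o]m+o≡n y≤x | m≤n⇒∃[o]m+o≡n x≤z
...   | p , refl | q , refl
  rewrite cycDist-+ʳ L (y + p) q | cycDist-+ˡ L y p | +-assoc y p q | cycDist-+ʳ L y (p + q)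
  = cycNorm-∸-subadditive L p q (≤-<-trans (m≤n+m (p + q) y) z<L)
cycDist-triangle-≤ L x y z x≤z y<L z<L | inj₂ x≤y | inj₁ y≤z with m≤n⇒∃[o]m+o≡n x≤y | m≤n⇒∃[o]m+o≡n y≤z
...   | p , refl | q , refl
  rewrite cycDist-+ʳ L x p | cycDist-+ʳ L (x + p) q | +-assoc x p q | cycDist-+ʳ L x (p + q)
  = cycNorm-subadditive L p q (≤-<-trans (m≤n+m (p + q) x) z<L)
cycDist-triangle-≤ L x y z x≤z y<L z<L | inj₂ x≤y | inj₂ z≤y with m≤n⇒∃[o]m+o≡n x≤z | m≤n⇒∃[o]m+o≡n z≤y
...   | p , refl | q , refl
  rewrite cycDist-+ʳ L x p | cycDist-+ˡ L (x + p) q | +-assoc x p q | cycDist-+ʳ L x (p + q)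
  = subst (cycNorm L p ≤_) (trans (+-comm (cycNorm L q) _) (cong (λ δ → cycNorm L δ + cycNorm L q) (+-comm q p)))
      (cycNorm-∸-subadditive L q p (subst (_< L) (+-comm p q) (≤-<-trans (m≤n+m (p + q) x) y<L)))

cycDist-triangle : ∀ L x y z → x < L → y < L → z < L → cycDist L x z ≤ cycDist L x y + cycDist L y z
cycDist-triangle L x y z x<L y<L z<L with ≤-total x z
... | inj₁ x≤z = cycDist-triangle-≤ L x y z x≤z y<L z<L
... | inj₂ z≤x = subst₂ _≤_ (cycDist-comm L z x)
      (trans (+-comm (cycDist L z y) _) (cong₂ _+_ (cycDist-comm L y x) (cycDist-comm L z y)))
      (cycDist-triangle-≤ L z y x z≤x y<L x<L)

cycNorm-1 : ∀ K → 2 ≤ K → cycNorm K 1 ≡ 1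
cycNorm-1 K (s≤s (s≤s _)) = refl

cycNorm≡1-bounded : ∀ K x δ → x + suc δ < K → cycNorm K (suc δ) ≡ 1 → δ ≡ 0 ⊎ (x ≡ 0 × suc (x + suc δ) ≡ K)
cycNorm≡1-bounded K x δ x+δ<K eq with cycNorm≡1 K (suc δ) eq
... | inj₁ refl = inj₁ refl
... | inj₂ K∸δ≡1 with m≤n⇒∃[o]m+o≡n x+δ<K
...   | k , refl = inj₂ (m+n≡0⇒m≡0 x x+k≡0 ,
                          sym (trans (cong (suc (x + suc δ) +_) (m+n≡0⇒n≡0 x x+k≡0)) (+-identityʳ _)))
  where
  rearrange : ∀ x δ k → 1 + (x + (1 + δ)) + k ≡ 1 + (x + k) + (1 + δ)
  rearrange = solve-∀
  x+k≡0 : x + k ≡ 0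
  x+k≡0 = suc-injective (trans (sym (trans (cong (_∸ suc δ) (rearrange x δ k)) (m+n∸n≡m (suc (x + k)) (suc δ)))) K∸δ≡1)

pathBound : ℕ → ℕ
pathBound 0 = 0
pathBound 1 = 1
pathBound 2 = 2
pathBound (suc (suc (suc n))) = 3 + 4 * n

pathBound-suc : ∀ ℓ → pathBound ℓ ≤ pathBound (suc ℓ)
pathBound-suc 0 = z≤n
pathBound-suc 1 = s≤s z≤n
pathBound-suc 2 = s≤s (s≤s z≤n)
pathBound-suc (suc (suc (suc n))) = +-monoʳ-≤ 3 (*-monoʳ-≤ 4 (n≤1+n n))

pathBound-mono : ∀ {m n} → m ≤ n → pathBound m ≤ pathBound n
pathBound-mono {m} {n} m≤n with m≤n⇒∃[o]m+o≡n m≤n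
... | k , refl = go k
  where
  go : ∀ k → pathBound m ≤ pathBound (m + k)
  go zero = ≤-reflexive (cong pathBound (sym (+-identityʳ m)))
  go (suc k) = ≤-trans (go k) (≤-trans (pathBound-suc (m + k)) (≤-reflexive (cong pathBound (sym (+-suc m k)))))

n≤pathBound : ∀ n → n ≤ pathBound n
n≤pathBound 0 = z≤n
n≤pathBound 1 = s≤s z≤n
n≤pathBound 2 = s≤s (s≤s z≤n)
n≤pathBound (suc (suc (suc n))) = +-monoʳ-≤ 3 (m≤m+n n (3 * n))

pathBound-split : ∀ {i r} → 2 ≤ i → 2 ≤ r → pathBound (suc i) + pathBound (suc r) ≤ pathBound (i + r)
pathBound-split {suc (suc i)} {suc (suc r)} (s≤s (s≤s _)) (s≤s (s≤s _)) rewrite +-suc i (suc r) | +-suc i r =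
  ≤-trans (n≤1+n _) (≤-reflexive (identity i r))
  where
  identity : ∀ i r → suc (3 + 4 * i + (3 + 4 * r)) ≡ 3 + 4 * suc (i + r)
  identity = solve-∀

pathBound[m+2] : ∀ m → 1 ≤ m → pathBound (m + 2) ≡ 4 * m ∸ 1
pathBound[m+2] (suc m) _ = trans (cong (λ n → pathBound (suc n)) (+-comm m 2)) (cong (_∸ 1) (sym (*-suc 4 m)))

m+2≤4m∸1 : ∀ m → 1 ≤ m → m + 2 ≤ 4 * m ∸ 1
m+2≤4m∸1 m 1≤m = subst (m + 2 ≤_) (pathBound[m+2] m 1≤m) (n≤pathBound (m + 2))

∸-suc : ∀ {i k} → i < k → k ∸ i ≡ suc (k ∸ suc i)
∸-suc {zero}  {suc k} _         = refl
∸-suc {suc i} {suc k} (s≤s i<k) = ∸-suc i<k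

∸-interior : ∀ {i k} → 0 < i → i < k → 0 < k ∸ i × k ∸ i < k
∸-interior 0<i i<k = m<n⇒0<n∸m i<k , ∸-monoʳ-< 0<i (<⇒≤ i<k)

∸-gap : ∀ {i j k} → 2 + i ≤ j → j ≤ k → 2 + (k ∸ j) ≤ k ∸ i
∸-gap {i} {j} {k} 2+i≤j j≤k = m+n≤o⇒m≤o∸n (2 + (k ∸ j)) (begin
  2 + (k ∸ j) + i   ≡⟨ cong (_+ i) (+-comm 2 (k ∸ j)) ⟩
  k ∸ j + 2 + i     ≡⟨ +-assoc (k ∸ j) 2 i ⟩
  k ∸ j + (2 + i)   ≤⟨ +-monoʳ-≤ (k ∸ j) 2+i≤j ⟩
  k ∸ j + j         ≡⟨ m∸n+n≡m j≤k ⟩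
  k                 ∎)
  where open ≤-Reasoning

+-<-halves : ∀ {x y L} → 2 * x ≤ L → 2 * y < L → x + y < L
+-<-halves {x} {y} {L} 2x≤L 2y<L = *-cancelˡ-< 2 (x + y) L (begin-strict
  2 * (x + y)     ≡⟨ *-distribˡ-+ 2 x y ⟩
  2 * x + 2 * y   <⟨ +-mono-≤-< 2x≤L 2y<L ⟩
  L + L           ≡⟨ cong (L +_) (sym (+-identityʳ L)) ⟩
  2 * L           ∎)
  where open ≤-Reasoning

half<self : ∀ {d L} → 0 < L → 2 * d ≤ L → d < L
half<self {zero}  0<L _    = 0<L
half<self {suc d} _   2d≤L = <-≤-trans (m<m+n (suc d) z<s) 2d≤L

half≤ : ∀ {d L k} → 2 * d ≤ L → L ≤ d + k → d ≤ k
half≤ {d} {L} {k} 2d≤L L≤d+k = +-cancelˡ-≤ d d k (≤-trans (subst (_≤ L) (cong (d +_) (+-identityʳ d)) 2d≤L) L≤d+k)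

module _ {p} {P : ℕ → Set p} (P? : Decidable P) where

  firstIn : ∀ {lo hi} → lo ≤ hi → P hi
    → Σ ℕ λ w → lo ≤ w × w ≤ hi × P w × (∀ {t} → lo ≤ t → t < w → ¬ P t)
  firstIn lo≤hi Phi with m≤n⇒∃[o]m+o≡n lo≤hi
  ... | k , refl = firstFrom _ k Phi
    where
      firstFrom : ∀ lo k → P (lo + k) → Σ ℕ λ w → lo ≤ w × w ≤ lo + k × P w × (∀ {t} → lo ≤ t → t < w → ¬ P t)
      firstFrom lo k P[lo+k] with P? lo
      ... | yes Plo = lo , ≤-refl , m≤m+n lo k , Plo , λ lo≤t t<lo _ → <-irrefl refl (≤-<-trans lo≤t t<lo)
      firstFrom lo zero    P[lo+k] | no ¬Plo = ⊥-elim (¬Plo (subst P (+-identityʳ lo) P[lo+k]))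
      firstFrom lo (suc k) P[lo+k] | no ¬Plo with firstFrom (suc lo) k (subst P (+-suc lo k) P[lo+k])
      ... | w , lo<w , w≤ , Pw , none = w , <⇒≤ lo<w , ≤-trans w≤ (≤-reflexive (sym (+-suc lo k))) , Pw , none′
        where
        none′ : ∀ {t} → lo ≤ t → t < w → ¬ P t
        none′ lo≤t t<w with m≤n⇒m<n∨m≡n lo≤t
        ... | inj₁ lo<t = none lo<t t<w
        ... | inj₂ refl = ¬Plo

  lastBelow : ∀ {lo} hi → lo < hi → P lo → Σ ℕ λ u → lo ≤ u × u < hi × P u × (∀ {t} → u < t → t < hi → ¬ P t)
  lastBelow (suc hi) (s≤s lo≤hi) Plo with P? hi
  ... | yes Phi = hi , lo≤hi , ≤-refl , Phi , λ hi<t t<1+hi _ → <-irrefl refl (≤-trans hi<t (≤-pred t<1+hi))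
  ... | no ¬Phi with m≤n⇒m<n∨m≡n lo≤hi
  ...   | inj₂ refl = ⊥-elim (¬Phi Plo)
  ...   | inj₁ lo<hi with lastBelow hi lo<hi Plo
  ...     | u , lo≤u , u<hi , Pu , none = u , lo≤u , m<n⇒m<1+n u<hi , Pu , none′
    where
    none′ : ∀ {t} → u < t → t < suc hi → ¬ P t
    none′ u<t (s≤s t≤hi) with m≤n⇒m<n∨m≡n t≤hi
    ... | inj₁ t<hi = none u<t t<hi
    ... | inj₂ refl = ¬Phi

clamp : ∀ ℓ → ℕ → Fin (suc ℓ)
clamp ℓ t = fromℕ< (s≤s (m⊓n≤n t ℓ))

toℕ-clamp : ∀ {ℓ t} → t ≤ ℓ → toℕ (clamp ℓ t) ≡ t
toℕ-clamp {ℓ} {t} t≤ℓ = trans (toℕ-fromℕ< (s≤s (m⊓n≤n t ℓ))) (m≤n⇒m⊓n≡m t≤ℓ)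

-- Holes given by a cyclic sequence of vertices

module _ (G : Graph) where
  open Graph G using (n; adj; irref) renaming (sym to adj-sym)

  E-sym : ∀ {u v} → E G u v → E G v u
  E-sym {u} {v} = subst T (adj-sym u v)

  E? : ∀ u v → Dec (E G u v)
  E? u v = T? (adj u v)

  module _ (K : ℕ) (f : ℕ → Fin n) (4≤K : 4 ≤ K)
    (f-inj : ∀ {i j} → i < j → j < K → f i ≢ f j)
    (f-suc : ∀ {i} → suc i < K → E G (f i) (f (suc i)))
    (f-wrap : E G (f (K ∸ 1)) (f 0))
    (f-chordless : ∀ {i j} → 2 + i ≤ j → j < K → ¬ (i ≡ 0 × suc j ≡ K) → ¬ E G (f i) (f j))
    where

    private
      2≤K : 2 ≤ K
      2≤K = ≤-trans (s≤s (s≤s z≤n)) 4≤K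

    adjacent⇒cycNorm≡1 : ∀ x δ → x + suc δ < K → E G (f x) (f (x + suc δ)) → cycNorm K (suc δ) ≡ 1
    adjacent⇒cycNorm≡1 x zero    _     _ = cycNorm-1 K 2≤K
    adjacent⇒cycNorm≡1 x (suc δ) x+δ<K e with x ≟ 0 ×-dec suc (x + suc (suc δ)) ≟ K
    ... | yes (refl , refl) = trans (cycNorm-∸ K 1 (≤-trans (n≤1+n 1) 2≤K)) (cycNorm-1 K 2≤K)
    ... | no ¬ends =
      ⊥-elim (f-chordless (subst (_≤ x + suc (suc δ)) (+-comm x 2) (+-monoʳ-≤ x (s≤s (s≤s z≤n)))) x+δ<K ¬ends e)

    cycNorm≡1⇒adjacent : ∀ x δ → x + suc δ < K → cycNorm K (suc δ) ≡ 1 → E G (f x) (f (x + suc δ))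
    cycNorm≡1⇒adjacent x δ x+δ<K eq with cycNorm≡1-bounded K x δ x+δ<K eq
    ... | inj₁ refl = subst (λ j → E G (f x) (f j)) (+-comm 1 x) (f-suc (subst (_< K) (+-comm x 1) x+δ<K))
    ... | inj₂ (refl , refl) = E-sym f-wrap

    Adjacency : ℕ → ℕ → Set
    Adjacency x y = (E G (f x) (f y) → cycDist K x y ≡ 1) × (cycDist K x y ≡ 1 → E G (f x) (f y))

    adjacency-< : ∀ {x y} → x < y → y < K → Adjacency x y
    adjacency-< {x} x<y y<K with m≤n⇒∃[o]m+o≡n x<y
    ... | δ , refl rewrite sym (+-suc x δ) | cycDist-+ʳ K x (suc δ) =
      adjacent⇒cycNorm≡1 x δ y<K , cycNorm≡1⇒adjacent x δ y<K

    adjacency : ∀ x y → x < K → y < K → Adjacency x y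
    adjacency x y x<K y<K with <-cmp x y
    ... | tri< x<y _ _ = adjacency-< x<y y<K
    ... | tri≈ _ refl _ = (λ e → ⊥-elim (irref (f x) e)) , λ d≡1 → ⊥-elim (0≢1+n (trans (sym (cycDist-refl K x)) d≡1))
    ... | tri> _ _ y<x with adjacency-< y<x x<K
    ...   | to , from = (λ e → trans (cycDist-comm K x y) (to (E-sym e))) , λ d≡1 → E-sym (from (trans (cycDist-comm K y x) d≡1))

    isHole-fromℕ : IsHole G K (λ i → f (toℕ i))
    isHole-fromℕ = 4≤K , injective , λ i j → adjacency (toℕ i) (toℕ j) (toℕ<n i) (toℕ<n j)
      where
      injective : ∀ {i j : Fin K} → f (toℕ i) ≡ f (toℕ j) → i ≡ j
      injective {i} {j} eq with <-cmp (toℕ i) (toℕ j)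
      ... | tri< i<j _ _ = ⊥-elim (f-inj i<j (toℕ<n j) eq)
      ... | tri≈ _ i≡j _ = toℕ-injective i≡j
      ... | tri> _ _ j<i = ⊥-elim (f-inj j<i (toℕ<n i) (sym eq))

-- The shortest hole C

module Cycle (G : Graph) (L : ℕ) (c : Fin L → Fin (Graph.n G)) (hole : IsHole G L c) where
  open Graph G using (n)

  4≤L : 4 ≤ L
  4≤L = proj₁ hole

  instance
    L≢0 : NonZero L
    L≢0 = >-nonZero (≤-trans (s≤s z≤n) 4≤L)

  c-injective : ∀ {i j} → c i ≡ c j → i ≡ j
  c-injective = proj₁ (proj₂ hole)

  c-adjacent : ∀ i j → (E G (c i) (c j) → distC L i j ≡ 1) × (distC L i j ≡ 1 → E G (c i) (c j))
  c-adjacent = proj₂ (proj₂ hole)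

  -- A periodic enumeration of V(C) in cyclic order, so that arcs of C become intervals of positions.
  record Traversal (pos : ℕ → Fin n) : Set where
    field
      onC         : ∀ t → Σ (Fin L) λ e → c e ≡ pos t
      onto        : ∀ e → Σ ℕ λ t → pos t ≡ c e
      periodic    : ∀ t → pos (t + L) ≡ pos t
      injective   : ∀ t δ → 0 < δ → δ < L → pos t ≢ pos (t + δ)
      adjacent    : ∀ t → E G (pos t) (pos (suc t))
      nonadjacent : ∀ t δ → 2 ≤ δ → δ + 2 ≤ L → ¬ E G (pos t) (pos (t + δ))

  rotation : Fin L → ℕ → Fin n
  rotation a t = c ((toℕ a + t) mod L)

  rotation-hits : ∀ a t e → (toℕ a + t) % L ≡ toℕ e → rotation a t ≡ c e
  rotation-hits a t e eq = cong c (toℕ-injective (trans (toℕ-fromℕ< (m%n<n (toℕ a + t) L)) eq))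

  rotation-0 : ∀ a → rotation a 0 ≡ c a
  rotation-0 a = rotation-hits a 0 a (trans (cong (_% L) (+-identityʳ (toℕ a))) (m<n⇒m%n≡m (toℕ<n a)))

  rotation-dist : ∀ (a : Fin L) t δ → δ < L → distC L ((toℕ a + t) mod L) ((toℕ a + (t + δ)) mod L) ≡ cycNorm L δ
  rotation-dist a t δ δ<L
    rewrite toℕ-fromℕ< (m%n<n (toℕ a + t) L) | toℕ-fromℕ< (m%n<n (toℕ a + (t + δ)) L) | sym (+-assoc (toℕ a) t δ)
    = cycDist-mod L (toℕ a + t) δ δ<L

  rotation-traversal : ∀ a → Traversal (rotation a)
  rotation-traversal a = record
    { onC         = λ t → (toℕ a + t) mod L , refl
    ; onto        = onto
    ; periodic    = λ t → cong c (toℕ-injective (trans (toℕ-fromℕ< _) (trans (cong (_% L) (sym (+-assoc (toℕ a) t L)))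
                      (trans ([m+n]%n≡m%n (toℕ a + t) L) (sym (toℕ-fromℕ< _))))))
    ; injective   = injective
    ; adjacent    = adjacent
    ; nonadjacent = nonadjacent
    }
    where
    2≤L : 2 ≤ L
    2≤L = ≤-trans (s≤s (s≤s z≤n)) 4≤L
    A = toℕ a
    onto : ∀ e → Σ ℕ λ t → rotation a t ≡ c e
    onto e = toℕ e + L ∸ A , rotation-hits a _ e (begin
      (A + (toℕ e + L ∸ A)) % L  ≡⟨ cong (_% L) (m+[n∸m]≡n (≤-trans (<⇒≤ (toℕ<n a)) (m≤n+m L (toℕ e)))) ⟩
      (toℕ e + L) % L            ≡⟨ [m+n]%n≡m%n (toℕ e) L ⟩
      toℕ e % L                  ≡⟨ m<n⇒m%n≡m (toℕ<n e) ⟩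
      toℕ e                      ∎)
      where open ≡-Reasoning
    injective : ∀ t δ → 0 < δ → δ < L → rotation a t ≢ rotation a (t + δ)
    injective t δ 0<δ δ<L eq = <⇒≢ (cycNorm-pos L δ 0<δ δ<L) (begin
      0                  ≡⟨ sym (cycDist-refl L (toℕ j)) ⟩
      distC L j j        ≡⟨ cong (λ i → distC L i j) (sym (c-injective eq)) ⟩
      distC L i j        ≡⟨ rotation-dist a t δ δ<L ⟩
      cycNorm L δ        ∎)
      where
      open ≡-Reasoning
      i = (A + t) mod L
      j = (A + (t + δ)) mod L
    adjacent : ∀ t → E G (rotation a t) (rotation a (suc t))
    adjacent t = proj₂ (c-adjacent _ _) (begin
      distC L ((A + t) mod L) ((A + suc t) mod L)    ≡⟨ cong (λ s → distC L ((A + t) mod L) ((A + s) mod L)) (+-comm 1 t) ⟩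
      distC L ((A + t) mod L) ((A + (t + 1)) mod L)  ≡⟨ rotation-dist a t 1 2≤L ⟩
      cycNorm L 1                                    ≡⟨ cycNorm-1 L 2≤L ⟩
      1                                              ∎)
      where open ≡-Reasoning
    nonadjacent : ∀ t δ → 2 ≤ δ → δ + 2 ≤ L → ¬ E G (rotation a t) (rotation a (t + δ))
    nonadjacent t δ 2≤δ δ+2≤L e with cycNorm≡1 L δ (trans (sym (rotation-dist a t δ δ<L)) (proj₁ (c-adjacent _ _) e))
      where
      δ<L : δ < L
      δ<L = ≤-trans (m≤m+n (suc δ) 1) (subst (_≤ L) (+-suc δ 1) δ+2≤L)
    ... | inj₁ refl = <-irrefl refl 2≤δ
    ... | inj₂ L∸δ≡1 = <-irrefl refl (subst (2 ≤_) L∸δ≡1 (m+n≤o⇒m≤o∸n 2 (subst (_≤ L) (+-comm δ 2) δ+2≤L)))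

  Oriented : (ℕ → Fin n) → Fin L → Fin L → Set
  Oriented pos a b = (pos 0 ≡ c a × pos (distC L a b) ≡ c b) ⊎ (pos 0 ≡ c b × pos (distC L a b) ≡ c a)

  oriented-swap : ∀ {pos} a b → Oriented pos a b → Oriented pos b a
  oriented-swap a b o with distC L a b | cycDist-comm L (toℕ a) (toℕ b)
  oriented-swap a b (inj₁ (p0 , pd)) | _ | refl = inj₂ (p0 , pd)
  oriented-swap a b (inj₂ (p0 , pd)) | _ | refl = inj₁ (p0 , pd)

  orient-≤ : ∀ a b → toℕ a ≤ toℕ b → Σ (ℕ → Fin n) λ pos → Traversal pos × Oriented pos a b
  orient-≤ a b a≤b with m≤n⇒∃[o]m+o≡n a≤b
  ... | δ , a+δ≡b with δ ≤? L ∸ δ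
  ...   | yes δ≤L∸δ = rotation a , rotation-traversal a ,
          inj₁ (rotation-0 a , trans (cong (rotation a) (trans dist≡ (m≤n⇒m⊓n≡m δ≤L∸δ)))
                                   (rotation-hits a δ b (trans (cong (_% L) a+δ≡b) (m<n⇒m%n≡m (toℕ<n b)))))
    where
    dist≡ : distC L a b ≡ cycNorm L δ
    dist≡ = trans (cong (cycDist L (toℕ a)) (sym a+δ≡b)) (cycDist-+ʳ L (toℕ a) δ)
  ...   | no δ≰L∸δ = rotation b , rotation-traversal b ,
          inj₂ (rotation-0 b , trans (cong (rotation b) (trans dist≡ (m≥n⇒m⊓n≡n (<⇒≤ (≰⇒> δ≰L∸δ)))))
                                   (rotation-hits b (L ∸ δ) a b+[L∸δ]%L≡a))
    where
    dist≡ : distC L a b ≡ cycNorm L δ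
    dist≡ = trans (cong (cycDist L (toℕ a)) (sym a+δ≡b)) (cycDist-+ʳ L (toℕ a) δ)
    δ≤L : δ ≤ L
    δ≤L = ≤-trans (m≤n+m δ (toℕ a)) (≤-trans (≤-reflexive a+δ≡b) (<⇒≤ (toℕ<n b)))
    b+[L∸δ]%L≡a : (toℕ b + (L ∸ δ)) % L ≡ toℕ a
    b+[L∸δ]%L≡a = begin
      (toℕ b + (L ∸ δ)) % L          ≡⟨ cong (λ x → (x + (L ∸ δ)) % L) (sym a+δ≡b) ⟩
      (toℕ a + δ + (L ∸ δ)) % L      ≡⟨ cong (_% L) (+-assoc (toℕ a) δ (L ∸ δ)) ⟩
      (toℕ a + (δ + (L ∸ δ))) % L    ≡⟨ cong (λ x → (toℕ a + x) % L) (m+[n∸m]≡n δ≤L) ⟩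
      (toℕ a + L) % L                ≡⟨ [m+n]%n≡m%n (toℕ a) L ⟩
      toℕ a % L                      ≡⟨ m<n⇒m%n≡m (toℕ<n a) ⟩
      toℕ a                          ∎
      where open ≡-Reasoning

  orient : ∀ a b → Σ (ℕ → Fin n) λ pos → Traversal pos × Oriented pos a b
  orient a b with ≤-total (toℕ a) (toℕ b)
  ... | inj₁ a≤b = orient-≤ a b a≤b
  ... | inj₂ b≤a with orient-≤ b a b≤a
  ...   | pos , T , o = pos , T , oriented-swap {pos} b a o

  distC-half : ∀ a b → 2 * distC L a b ≤ L
  distC-half a b = cycDist-half L (toℕ a) (toℕ b) (<⇒≤ (toℕ<n a)) (<⇒≤ (toℕ<n b))

  module _ {pos : ℕ → Fin n} (T : Traversal pos) where
    open Traversal T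

    periodic-* : ∀ t k → pos (t + k * L) ≡ pos t
    periodic-* t zero    = cong pos (+-identityʳ t)
    periodic-* t (suc k) = begin
      pos (t + (L + k * L))  ≡⟨ cong pos (trans (cong (t +_) (+-comm L (k * L))) (sym (+-assoc t (k * L) L))) ⟩
      pos (t + k * L + L)    ≡⟨ periodic (t + k * L) ⟩
      pos (t + k * L)        ≡⟨ periodic-* t k ⟩
      pos t                  ∎
      where open ≡-Reasoning

    periodic-representative : ∀ t₀ t₁ → Σ ℕ λ t → t₁ ≤ t × t < t₁ + L × pos t ≡ pos t₀
    periodic-representative t₀ t₁ = t₁ + X % L , m≤m+n t₁ _ , +-monoʳ-< t₁ (m%n<n X L) , (begin
      pos (t₁ + X % L)                 ≡⟨ sym (periodic-* (t₁ + X % L) (X / L)) ⟩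
      pos (t₁ + X % L + (X / L) * L)   ≡⟨ cong pos (+-assoc t₁ (X % L) _) ⟩
      pos (t₁ + (X % L + (X / L) * L)) ≡⟨ cong (λ x → pos (t₁ + x)) (sym (m≡m%n+[m/n]*n X L)) ⟩
      pos (t₁ + X)                     ≡⟨ cong pos (m+[n∸m]≡n t₁≤) ⟩
      pos (t₀ + t₁ * L)                ≡⟨ periodic-* t₀ t₁ ⟩
      pos t₀                           ∎)
      where
      open ≡-Reasoning
      X = t₀ + t₁ * L ∸ t₁
      t₁≤ : t₁ ≤ t₀ + t₁ * L
      t₁≤ = ≤-trans (subst (_≤ t₁ * L) (*-identityʳ t₁) (*-monoʳ-≤ t₁ (≤-trans (s≤s z≤n) 4≤L)))
              (m≤n+m (t₁ * L) t₀)

    injective-in-window : ∀ {t t′} → t < t′ → t′ < t + L → pos t ≢ pos t′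
    injective-in-window {t} t<t′ t′<t+L with m≤n⇒∃[o]m+o≡n t<t′
    ... | δ , refl = subst (pos t ≢_) (cong pos (+-suc t δ))
                       (injective t (suc δ) z<s (+-cancelˡ-< t _ _ (subst (_< t + L) (sym (+-suc t δ)) t′<t+L)))

    -- The inner vertices r 1, …, r (k ∸ 1) of an induced V(C)-path, read in the traversal pos.
    record InnerPath (k : ℕ) (r : ℕ → Fin n) : Set where
      field
        offC      : ∀ {i} → 0 < i → i < k → ∀ t → r i ≢ pos t
        offD      : ∀ {i} → 0 < i → i < k → Σ ℕ λ t → ¬ E G (r i) (pos t)
        distinct  : ∀ {i j} → 0 < i → i < j → j < k → r i ≢ r j
        step      : ∀ {i} → 0 < i → suc i < k → E G (r i) (r (suc i))
        chordless : ∀ {i j} → 0 < i → 2 + i ≤ j → j < k → ¬ E G (r i) (r j)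
        quiet     : ∀ {i} → 1 < i → suc i < k → ∀ t → ¬ E G (r i) (pos t)

    innerPath-reverse : ∀ {k r} → InnerPath k r → InnerPath k (λ i → r (k ∸ i))
    innerPath-reverse {k} {r} R = record
      { offC      = λ 0<i i<k → offC (proj₁ (∸-interior 0<i i<k)) (proj₂ (∸-interior 0<i i<k))
      ; offD      = λ 0<i i<k → offD (proj₁ (∸-interior 0<i i<k)) (proj₂ (∸-interior 0<i i<k))
      ; distinct  = λ 0<i i<j j<k eq → distinct (proj₁ (∸-interior (<-trans 0<i i<j) j<k)) (∸-monoʳ-< i<j (<⇒≤ j<k))
                                         (proj₂ (∸-interior 0<i (<-trans i<j j<k))) (sym eq)
      ; step      = λ {i} 0<i 1+i<k → let i<k = <-trans (n<1+n i) 1+i<k in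
                      E-sym G (subst (λ x → E G (r (k ∸ suc i)) (r x)) (sym (∸-suc i<k))
                        (step (m<n⇒0<n∸m 1+i<k) (subst (_< k) (∸-suc i<k) (proj₂ (∸-interior 0<i i<k)))))
      ; chordless = λ 0<i 2+i≤j j<k e → chordless (m<n⇒0<n∸m j<k) (∸-gap 2+i≤j (<⇒≤ j<k))
                      (proj₂ (∸-interior 0<i (<-trans (≤-trans (n≤1+n _) 2+i≤j) j<k))) (E-sym G e)
      ; quiet     = λ {i} 1<i 1+i<k → quiet (m+n≤o⇒m≤o∸n 2 1+i<k) (∸-gap 1<i (<⇒≤ (<-trans (n<1+n i) 1+i<k)))
      }
      where open InnerPath R

    -- An induced path r 1, …, r (k ∸ 1) off C closing the arc pos u, …, pos (u + s) into a chordless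
    -- cycle of length s + k.
    record Detour (u s k : ℕ) (r : ℕ → Fin n) : Set where
      field
        offC      : ∀ {i} → 0 < i → i < k → ∀ t → r i ≢ pos t
        distinct  : ∀ {i j} → 0 < i → i < j → j < k → r i ≢ r j
        start     : E G (pos (u + s)) (r 1)
        step      : ∀ {i} → 0 < i → suc i < k → E G (r i) (r (suc i))
        end       : E G (r (k ∸ 1)) (pos u)
        chordless : ∀ {i j} → 0 < i → 2 + i ≤ j → j < k → ¬ E G (r i) (r j)
        arc-edges : ∀ {i t} → 0 < i → i < k → t ≤ s → E G (r i) (pos (u + t))
                    → (i ≡ 1 × t ≡ s) ⊎ (suc i ≡ k × t ≡ 0)

  -- Paths are indexed by ℕ (values beyond ℓ are irrelevant), so that they can be cut, reversed and
  -- shortcut without Fin arithmetic.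
  record VCPath (ℓ : ℕ) (q : ℕ → Fin n) (a b : Fin L) : Set where
    field
      injective : ∀ {i j} → i ≤ ℓ → j ≤ ℓ → q i ≡ q j → i ≡ j
      adjacent  : ∀ {i} → i < ℓ → E G (q i) (q (suc i))
      start     : q 0 ≡ c a
      end       : q ℓ ≡ c b
      offC      : ∀ {i} → 0 < i → i < ℓ → ∀ e → q i ≢ c e
      offD      : ∀ {i} → 0 < i → i < ℓ → Σ (Fin L) λ e → ¬ E G (q i) (c e)

  Chordless : ℕ → (ℕ → Fin n) → Set
  Chordless ℓ q = ∀ {i j} → 2 + i ≤ j → j ≤ ℓ → ¬ E G (q i) (q j)

  Quiet : ℕ → (ℕ → Fin n) → Set
  Quiet ℓ q = ∀ {i} → 1 < i → suc i < ℓ → ∀ e → ¬ E G (q i) (c e)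

  vcPath-reverse : ∀ {ℓ q a b} → VCPath ℓ q a b → VCPath ℓ (λ t → q (ℓ ∸ t)) b a
  vcPath-reverse {ℓ} {q} P = record
    { injective = λ {i} {j} i≤ℓ j≤ℓ eq → ∸-cancelˡ-≡ i≤ℓ j≤ℓ (injective (m∸n≤m ℓ i) (m∸n≤m ℓ j) eq)
    ; adjacent  = λ {i} i<ℓ → E-sym G (subst (λ x → E G (q (ℓ ∸ suc i)) (q x)) (sym (∸-suc i<ℓ))
                    (adjacent (subst (_≤ ℓ) (∸-suc i<ℓ) (m∸n≤m ℓ i))))
    ; start     = end
    ; end       = trans (cong q (n∸n≡0 ℓ)) start
    ; offC      = λ 0<i i<ℓ → offC (proj₁ (∸-interior 0<i i<ℓ)) (proj₂ (∸-interior 0<i i<ℓ))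
    ; offD      = λ 0<i i<ℓ → offD (proj₁ (∸-interior 0<i i<ℓ)) (proj₂ (∸-interior 0<i i<ℓ))
    }
    where open VCPath P

  vcPath-subsequence : ∀ {ℓ q a b} → VCPath ℓ q a b → ∀ ℓ′ (φ : ℕ → ℕ) → φ 0 ≡ 0 → φ ℓ′ ≡ ℓ
    → (∀ {t t′} → t < t′ → t′ ≤ ℓ′ → φ t < φ t′)
    → (∀ {t} → t < ℓ′ → E G (q (φ t)) (q (φ (suc t))))
    → VCPath ℓ′ (q ∘ φ) a b
  vcPath-subsequence {ℓ} {q} P ℓ′ φ φ0≡0 φℓ′≡ℓ φ-mono φ-adjacent = record
    { injective = injective′
    ; adjacent  = φ-adjacent
    ; start     = trans (cong q φ0≡0) start
    ; end       = trans (cong q φℓ′≡ℓ) end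
    ; offC      = λ 0<i i<ℓ′ → offC (0<φ 0<i i<ℓ′) (φ<ℓ i<ℓ′)
    ; offD      = λ 0<i i<ℓ′ → offD (0<φ 0<i i<ℓ′) (φ<ℓ i<ℓ′)
    }
    where
    open VCPath P
    φ<ℓ : ∀ {t} → t < ℓ′ → φ t < ℓ
    φ<ℓ t<ℓ′ = subst (_ <_) φℓ′≡ℓ (φ-mono t<ℓ′ ≤-refl)
    0<φ : ∀ {t} → 0 < t → t < ℓ′ → 0 < φ t
    0<φ {t} 0<t t<ℓ′ = subst (_< φ t) φ0≡0 (φ-mono 0<t (<⇒≤ t<ℓ′))
    φ≤ℓ : ∀ {t} → t ≤ ℓ′ → φ t ≤ ℓ
    φ≤ℓ t≤ℓ′ with m≤n⇒m<n∨m≡n t≤ℓ′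
    ... | inj₁ t<ℓ′ = <⇒≤ (φ<ℓ t<ℓ′)
    ... | inj₂ refl = ≤-reflexive φℓ′≡ℓ
    injective′ : ∀ {i j} → i ≤ ℓ′ → j ≤ ℓ′ → q (φ i) ≡ q (φ j) → i ≡ j
    injective′ {i} {j} i≤ℓ′ j≤ℓ′ eq with <-cmp i j
    ... | tri< i<j _ _ = ⊥-elim (<-irrefl (injective (φ≤ℓ i≤ℓ′) (φ≤ℓ j≤ℓ′) eq) (φ-mono i<j j≤ℓ′))
    ... | tri≈ _ i≡j _ = i≡j
    ... | tri> _ _ j<i = ⊥-elim (<-irrefl (sym (injective (φ≤ℓ i≤ℓ′) (φ≤ℓ j≤ℓ′) eq)) (φ-mono j<i i≤ℓ′))

  vcPath-shortcut : ∀ {ℓ q a b i j} → VCPath ℓ q a b → 2 + i ≤ j → j ≤ ℓ → E G (q i) (q j)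
    → Σ ℕ λ ℓ′ → ℓ′ < ℓ × Σ (ℕ → Fin n) λ q′ → VCPath ℓ′ q′ a b
  vcPath-shortcut {q = q} {i = i} P 2+i≤j j≤ℓ chord
    with m≤n⇒∃[o]m+o≡n (≤-trans (n≤1+n (suc i)) 2+i≤j) | m≤n⇒∃[o]m+o≡n j≤ℓ
  ... | m , refl | r , refl =
    suc i + r , +-monoˡ-< r (m<m+n (suc i) 1≤m) , q ∘ φ ,
    vcPath-subsequence P (suc i + r) φ refl φ-end φ-mono φ-adjacent
    where
    1≤m : 1 ≤ m
    1≤m = +-cancelˡ-≤ (suc i) 1 m (subst (_≤ suc i + m) (+-comm 1 (suc i)) 2+i≤j)
    φ : ℕ → ℕ
    φ t with t ≤? i
    ... | yes _ = t
    ... | no  _ = t + m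
    φ-≤ : ∀ {t} → t ≤ i → φ t ≡ t
    φ-≤ {t} t≤i with t ≤? i
    ... | yes _   = refl
    ... | no  t≰i = ⊥-elim (t≰i t≤i)
    φ-> : ∀ {t} → i < t → φ t ≡ t + m
    φ-> {t} i<t with t ≤? i
    ... | yes t≤i = ⊥-elim (<-irrefl refl (<-≤-trans i<t t≤i))
    ... | no  _   = refl
    φ-end : φ (suc i + r) ≡ suc i + m + r
    φ-end = trans (φ-> (s≤s (m≤m+n i r))) (+-swapʳ (suc i) r m)
    φ-mono : ∀ {t t′} → t < t′ → t′ ≤ suc i + r → φ t < φ t′
    φ-mono {t} {t′} t<t′ _ with t′ ≤? i | t ≤? i
    ... | yes _    | yes _   = t<t′
    ... | yes t′≤i | no  t≰i = ⊥-elim (t≰i (≤-trans (<⇒≤ t<t′) t′≤i))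
    ... | no  _    | yes _   = ≤-trans t<t′ (m≤m+n t′ m)
    ... | no  _    | no  _   = +-monoˡ-< m t<t′
    φ-adjacent : ∀ {t} → t < suc i + r → E G (q (φ t)) (q (φ (suc t)))
    φ-adjacent {t} t<ℓ′ with <-cmp t i
    ... | tri< t<i _ _ rewrite φ-≤ (<⇒≤ t<i) | φ-≤ t<i =
      VCPath.adjacent P (<-≤-trans t<i (≤-trans (n≤1+n i) (≤-trans (m≤m+n (suc i) m) (m≤m+n _ r))))
    ... | tri≈ _ refl _ rewrite φ-≤ (≤-refl {t}) | φ-> (n<1+n t) = chord
    ... | tri> _ _ i<t rewrite φ-> i<t | φ-> (<-trans i<t (n<1+n t)) =
      VCPath.adjacent P (subst (t + m <_) (+-swapʳ (suc i) r m) (+-monoˡ-< m t<ℓ′))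

  vcPath-prefix : ∀ {ℓ q a b i e} → VCPath ℓ q a b → 0 < i → i < ℓ → E G (q i) (c e) → c e ≢ q 0
    → Σ (ℕ → Fin n) λ q′ → VCPath (suc i) q′ a e
  vcPath-prefix {ℓ} {q} {i = i} {e} P 0<i i<ℓ qi~e e≢q0 = q′ , record
    { injective = injective′
    ; adjacent  = adjacent′
    ; start     = trans (q′-≤ z≤n) start
    ; end       = q′-> ≤-refl
    ; offC      = λ {t} 0<t t<1+i → subst (λ v → ∀ e → v ≢ c e) (sym (q′-≤ (≤-pred t<1+i)))
                    (offC 0<t (<-≤-trans t<1+i i<ℓ))
    ; offD      = λ {t} 0<t t<1+i → subst (λ v → Σ (Fin L) λ e → ¬ E G v (c e)) (sym (q′-≤ (≤-pred t<1+i)))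
                    (offD 0<t (<-≤-trans t<1+i i<ℓ))
    }
    where
    open VCPath P
    q′ : ℕ → Fin n
    q′ t with t ≤? i
    ... | yes _ = q t
    ... | no  _ = c e
    q′-≤ : ∀ {t} → t ≤ i → q′ t ≡ q t
    q′-≤ {t} t≤i with t ≤? i
    ... | yes _   = refl
    ... | no  t≰i = ⊥-elim (t≰i t≤i)
    q′-> : ∀ {t} → i < t → q′ t ≡ c e
    q′-> {t} i<t with t ≤? i
    ... | yes t≤i = ⊥-elim (<-irrefl refl (<-≤-trans i<t t≤i))
    ... | no  _   = refl
    q≢e : ∀ {t} → t ≤ i → q t ≢ c e
    q≢e {zero}  _     eq = e≢q0 (sym eq)
    q≢e {suc t} 1+t≤i    = offC z<s (<-≤-trans (s≤s 1+t≤i) i<ℓ) e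
    injective′ : ∀ {t t′} → t ≤ suc i → t′ ≤ suc i → q′ t ≡ q′ t′ → t ≡ t′
    injective′ {t} {t′} t≤1+i t′≤1+i eq with t ≤? i | t′ ≤? i
    ... | yes t≤i | yes t′≤i = injective (≤-trans t≤i (<⇒≤ i<ℓ)) (≤-trans t′≤i (<⇒≤ i<ℓ)) eq
    ... | yes t≤i | no  _    = ⊥-elim (q≢e t≤i eq)
    ... | no  _   | yes t′≤i = ⊥-elim (q≢e t′≤i (sym eq))
    ... | no  t≰i | no  t′≰i = trans (≤-antisym t≤1+i (≰⇒> t≰i)) (sym (≤-antisym t′≤1+i (≰⇒> t′≰i)))
    adjacent′ : ∀ {t} → t < suc i → E G (q′ t) (q′ (suc t))
    adjacent′ {t} (s≤s t≤i) with m≤n⇒m<n∨m≡n t≤i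
    ... | inj₁ t<i rewrite q′-≤ (<⇒≤ t<i) | q′-≤ t<i = adjacent (<-trans t<i i<ℓ)
    ... | inj₂ refl rewrite q′-≤ (≤-refl {t}) | q′-> (n<1+n t) = qi~e

  quiet-length3 : ∀ {q} → Quiet 3 q
  quiet-length3 1<i 1+i<3 = ⊥-elim (<-irrefl refl (≤-trans 1+i<3 (s≤s 1<i)))

  module _ {ℓ q a b} (P : VCPath ℓ q a b) (chordless : Chordless ℓ q) (3≤ℓ : 3 ≤ ℓ) where
    open VCPath P

    private
      ℓ∸1<ℓ : ℓ ∸ 1 < ℓ
      ℓ∸1<ℓ = ∸-monoʳ-< z<s (≤-trans (s≤s z≤n) 3≤ℓ)
      suc[ℓ∸1]≡ℓ : suc (ℓ ∸ 1) ≡ ℓ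
      suc[ℓ∸1]≡ℓ = m+[n∸m]≡n (≤-trans (s≤s z≤n) 3≤ℓ)

    second~start : E G (q 1) (c a)
    second~start = subst (E G (q 1)) start (E-sym G (adjacent (≤-trans (s≤s z≤n) 3≤ℓ)))

    penultimate~end : E G (q (ℓ ∸ 1)) (c b)
    penultimate~end = subst (E G (q (ℓ ∸ 1))) (trans (cong q suc[ℓ∸1]≡ℓ) end) (adjacent ℓ∸1<ℓ)

    second≁end : ¬ E G (q 1) (c b)
    second≁end = chordless 3≤ℓ ≤-refl ∘ subst (E G (q 1)) (sym end)

    penultimate≁start : ¬ E G (q (ℓ ∸ 1)) (c a)
    penultimate≁start =
      chordless {0} (∸-monoˡ-≤ 1 3≤ℓ) (<⇒≤ ℓ∸1<ℓ) ∘ E-sym G ∘ subst (E G (q (ℓ ∸ 1))) (sym start)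

  module _ {pos} (T : Traversal pos) where
    open Traversal T using (onC; onto)

    offC-frame : ∀ {v} → (∀ e → v ≢ c e) → ∀ t → v ≢ pos t
    offC-frame v∉C t eq = v∉C (proj₁ (onC t)) (trans eq (sym (proj₂ (onC t))))

    offD-frame : ∀ {v} → (Σ (Fin L) λ e → ¬ E G v (c e)) → Σ ℕ λ t → ¬ E G v (pos t)
    offD-frame {v} (e , ¬ve) = proj₁ (onto e) , ¬ve ∘ subst (E G v) (proj₂ (onto e))

    onC-common : ∀ {x y t} → E G x (pos t) → E G y (pos t) → Σ (Fin L) λ e → E G x (c e) × E G y (c e)
    onC-common {x} {y} {t} xt yt = proj₁ (onC t) , subst (E G x) (sym (proj₂ (onC t))) xt , subst (E G y) (sym (proj₂ (onC t))) yt

    innerPath : ∀ {ℓ q a b} → VCPath ℓ q a b → Chordless ℓ q → Quiet ℓ q → InnerPath T ℓ q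
    innerPath {q = q} P chordless quiet = record
      { offC      = λ 0<i i<ℓ → offC-frame (offC 0<i i<ℓ)
      ; offD      = λ 0<i i<ℓ → offD-frame (offD 0<i i<ℓ)
      ; distinct  = λ 0<i i<j j<ℓ eq → <⇒≢ i<j (injective (<⇒≤ (<-trans i<j j<ℓ)) (<⇒≤ j<ℓ) eq)
      ; step      = λ _ 1+i<ℓ → adjacent (<-trans (n<1+n _) 1+i<ℓ)
      ; chordless = λ _ 2+i≤j j<ℓ → chordless 2+i≤j (<⇒≤ j<ℓ)
      ; quiet     = λ {i} 1<i 1+i<ℓ t → quiet 1<i 1+i<ℓ (proj₁ (onC t)) ∘ subst (E G (q i)) (sym (proj₂ (onC t)))
      }
      where open VCPath P

  oriented-ends : ∀ {pos a b} (P : Fin n → Set) → Oriented pos a b → P (c a) → P (c b) → P (pos 0) × P (pos (distC L a b))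
  oriented-ends P (inj₁ (p0 , pd)) Pa Pb = subst P (sym p0) Pa , subst P (sym pd) Pb
  oriented-ends P (inj₂ (p0 , pd)) Pa Pb = subst P (sym p0) Pb , subst P (sym pd) Pa

  Chord : ℕ → (ℕ → Fin n) → Set
  Chord ℓ q = Σ ℕ λ i → Σ ℕ λ j → 2 + i ≤ j × j ≤ ℓ × E G (q i) (q j)

  chord-or-chordless : ∀ ℓ q → Chord ℓ q ⊎ Chordless ℓ q
  chord-or-chordless ℓ q with anyUpTo? (λ j → anyUpTo? (λ i → (2 + i ≤? j) ×-dec E? G (q i) (q j)) j) (suc ℓ)
  ... | yes (j , j<1+ℓ , i , _ , 2+i≤j , e) = inj₁ (i , j , 2+i≤j , ≤-pred j<1+ℓ , e)
  ... | no ¬chord =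
    inj₂ λ {i} {j} 2+i≤j j≤ℓ e → ¬chord (j , s≤s j≤ℓ , i , ≤-trans (n≤1+n (suc i)) 2+i≤j , 2+i≤j , e)

  Noisy : ℕ → (ℕ → Fin n) → Set
  Noisy ℓ q = Σ ℕ λ i → 1 < i × suc i < ℓ × Σ (Fin L) λ e → E G (q i) (c e)

  noisy-or-quiet : ∀ ℓ q → Noisy ℓ q ⊎ Quiet ℓ q
  noisy-or-quiet ℓ q with anyUpTo? (λ i → (1 <? i) ×-dec ((suc i <? ℓ) ×-dec any? (λ e → E? G (q i) (c e)))) ℓ
  ... | yes (i , _ , 1<i , 1+i<ℓ , e , qi~e) = inj₁ (i , 1<i , 1+i<ℓ , e , qi~e)
  ... | no ¬noisy = inj₂ λ {i} 1<i 1+i<ℓ e qi~e → ¬noisy (i , <-trans (n<1+n i) 1+i<ℓ , 1<i , 1+i<ℓ , e , qi~e)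

  vcPath-fromFin : ∀ {ℓ p a b} → IsVCPathInGminusD G L c ℓ p → c a ≡ p fzero → c b ≡ p (fromℕ ℓ)
    → VCPath ℓ (p ∘ clamp ℓ) a b
  vcPath-fromFin {ℓ} {p} ((p-injective , p-adjacent) , _ , _ , _ , inner-offC , offD) ca cb = record
    { injective = λ i≤ℓ j≤ℓ eq → trans (sym (toℕ-clamp i≤ℓ)) (trans (cong toℕ (p-injective eq)) (toℕ-clamp j≤ℓ))
    ; adjacent  = λ {i} i<ℓ → subst₂ (λ x y → E G (p x) (p y))
                    (toℕ-injective (trans (toℕ-inject₁ (fromℕ< i<ℓ))
                                     (trans (toℕ-fromℕ< i<ℓ) (sym (toℕ-clamp (<⇒≤ i<ℓ))))))
                    (toℕ-injective (trans (cong suc (toℕ-fromℕ< i<ℓ)) (sym (toℕ-clamp i<ℓ))))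
                    (p-adjacent (fromℕ< i<ℓ))
    ; start     = trans (cong p (toℕ-injective (toℕ-clamp {ℓ} z≤n))) (sym ca)
    ; end       = trans (cong p (toℕ-injective (trans (toℕ-clamp ≤-refl) (sym (toℕ-fromℕ ℓ))))) (sym cb)
    ; offC      = λ {i} 0<i i<ℓ e eq → inner-offC (clamp ℓ i)
                    (λ i≡0 → <⇒≢ 0<i (sym (trans (sym (toℕ-clamp (<⇒≤ i<ℓ))) i≡0)))
                    (λ i≡ℓ → <⇒≢ i<ℓ (trans (sym (toℕ-clamp (<⇒≤ i<ℓ))) i≡ℓ))
                    (e , sym eq)
    ; offD      = λ {i} _ _ → ¬∀⟶∃¬ L _ (λ e → E? G (p (clamp ℓ i)) (c e)) (offD (clamp ℓ i))
    }

  module Shortest (shortest : ∀ L′ h → IsHole G L′ h → L ≤ L′) where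

    module _ {pos : ℕ → Fin n} (T : Traversal pos) where
      open Traversal T

      detour-length≥L : ∀ {u s k r} → 1 ≤ s → s + 2 ≤ L → 2 ≤ k → 4 ≤ s + k → Detour T u s k r → L ≤ s + k
      detour-length≥L {u} {s} {k} {r} 1≤s s+2≤L 2≤k 4≤s+k D =
        shortest (s + k) _ (isHole-fromℕ G (s + k) f 4≤s+k f-inj f-suc f-wrap f-chordless)
        where
        open Detour D
        K = s + k

        f : ℕ → Fin n
        f i with i ≤? s
        ... | yes _ = pos (u + i)
        ... | no  _ = r (i ∸ s)

        f-arc : ∀ {i} → i ≤ s → f i ≡ pos (u + i)
        f-arc {i} i≤s with i ≤? s
        ... | yes _ = refl
        ... | no i≰s = ⊥-elim (i≰s i≤s)

        f-detour : ∀ {j} → 0 < j → f (s + j) ≡ r j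
        f-detour {j} 0<j with s + j ≤? s
        ... | yes s+j≤s = ⊥-elim (<-irrefl refl (≤-trans (m<m+n s 0<j) s+j≤s))
        ... | no  _     = cong r (m+n∸m≡n s j)

        position : ∀ i → i ≤ s ⊎ Σ ℕ λ j → 0 < j × s + j ≡ i
        position i with i ≤? s
        ... | yes i≤s = inj₁ i≤s
        ... | no  i≰s with m≤n⇒∃[o]m+o≡n (<⇒≤ (≰⇒> i≰s))
        ...   | zero  , s+0≡i = ⊥-elim (i≰s (≤-reflexive (trans (sym s+0≡i) (+-identityʳ s))))
        ...   | suc j , s+j≡i = inj₂ (suc j , z<s , s+j≡i)

        s<L : s < L
        s<L = ≤-trans (m≤m+n (suc s) 1) (subst (_≤ L) (+-suc s 1) s+2≤L)

        f-inj : ∀ {i j} → i < j → j < K → f i ≢ f j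
        f-inj {i} {j} i<j j<K with position i | position j
        ... | inj₁ i≤s | inj₁ j≤s rewrite f-arc i≤s | f-arc j≤s =
          injective-in-window T (+-monoʳ-< u i<j)
            (subst (u + j <_) (sym (+-assoc u i L)) (+-monoʳ-< u (<-≤-trans (s≤s j≤s) (≤-trans s<L (m≤n+m L i)))))
        ... | inj₁ i≤s | inj₂ (j′ , 0<j′ , refl) rewrite f-arc i≤s | f-detour 0<j′ =
          λ eq → offC 0<j′ (+-cancelˡ-< s j′ k j<K) (u + i) (sym eq)
        ... | inj₂ (i′ , _ , refl) | inj₁ j≤s = ⊥-elim (<-irrefl refl (<-≤-trans i<j (≤-trans j≤s (m≤m+n s i′))))
        ... | inj₂ (i′ , 0<i′ , refl) | inj₂ (j′ , 0<j′ , refl) rewrite f-detour 0<i′ | f-detour 0<j′ =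
          distinct 0<i′ (+-cancelˡ-< s i′ j′ i<j) (+-cancelˡ-< s j′ k j<K)

        f-suc : ∀ {i} → suc i < K → E G (f i) (f (suc i))
        f-suc {i} 1+i<K with position i | position (suc i)
        ... | inj₁ i≤s | inj₁ 1+i≤s rewrite f-arc i≤s | f-arc 1+i≤s | +-suc u i = adjacent (u + i)
        ... | inj₁ i≤s | inj₂ (j , 0<j , s+j≡1+i)
          with ≤-antisym i≤s (≤-pred (subst (suc s ≤_) s+j≡1+i (subst (_≤ s + j) (+-comm s 1) (+-monoʳ-≤ s 0<j))))
        ...   | refl = subst₂ (E G) (sym (f-arc i≤s)) (trans (sym (f-detour z<s)) (cong f (+-comm s 1))) start
        f-suc 1+i<K | inj₂ (i′ , 0<i′ , refl) | _ =
          subst₂ (E G) (sym (f-detour 0<i′)) (sym (trans (cong f (sym (+-suc s i′))) (f-detour {suc i′} z<s)))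
            (step 0<i′ (+-cancelˡ-< s _ _ (subst (_< K) (sym (+-suc s i′)) 1+i<K)))

        f-wrap : E G (f (K ∸ 1)) (f 0)
        f-wrap = subst₂ (E G)
          (sym (trans (cong f (+-∸-assoc s {k} {1} (≤-trans (s≤s z≤n) 2≤k))) (f-detour (∸-monoˡ-≤ 1 2≤k))))
          (sym (trans (f-arc z≤n) (cong pos (+-identityʳ u)))) end

        f-chordless : ∀ {i j} → 2 + i ≤ j → j < K → ¬ (i ≡ 0 × suc j ≡ K) → ¬ E G (f i) (f j)
        f-chordless {i} {j} 2+i≤j j<K ¬ends e with position i | position j
        ... | inj₁ i≤s | inj₁ j≤s with m≤n⇒∃[o]m+o≡n (≤-trans (m≤n+m i 2) 2+i≤j)
        ...   | δ , refl rewrite f-arc i≤s | f-arc j≤s =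
          nonadjacent (u + i) δ (+-cancelˡ-≤ i 2 δ (subst (_≤ i + δ) (+-comm 2 i) 2+i≤j))
            (≤-trans (+-monoˡ-≤ 2 (≤-trans (m≤n+m δ i) j≤s)) s+2≤L)
            (subst (λ x → E G (pos (u + i)) (pos x)) (sym (+-assoc u i δ)) e)
        f-chordless {i} {j} 2+i≤j j<K ¬ends e | inj₁ i≤s | inj₂ (j′ , 0<j′ , refl) rewrite f-arc i≤s | f-detour 0<j′
          with arc-edges 0<j′ (+-cancelˡ-< s j′ k j<K) i≤s (E-sym G e)
        ... | inj₁ (refl , refl) = <-irrefl refl (subst (suc (suc i) ≤_) (+-comm i 1) 2+i≤j)
        ... | inj₂ (1+j′≡k , refl) = ¬ends (refl , trans (sym (+-suc s j′)) (cong (s +_) 1+j′≡k))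
        f-chordless 2+i≤j j<K ¬ends e | inj₂ (i′ , _ , refl) | inj₁ j≤s =
          <-irrefl refl (≤-trans (s≤s (m≤m+n s i′)) (≤-trans (n≤1+n _) (≤-trans 2+i≤j j≤s)))
        f-chordless 2+i≤j j<K ¬ends e | inj₂ (i′ , 0<i′ , refl) | inj₂ (j′ , 0<j′ , refl)
          rewrite f-detour 0<i′ | f-detour 0<j′ =
          chordless 0<i′ (+-cancelˡ-≤ s (2 + i′) j′ (subst (_≤ s + j′) (sym s+[2+i′]≡2+[s+i′]) 2+i≤j)) (+-cancelˡ-< s j′ k j<K) e
          where
          s+[2+i′]≡2+[s+i′] : s + (2 + i′) ≡ 2 + (s + i′)
          s+[2+i′]≡2+[s+i′] = trans (+-suc s (suc i′)) (cong suc (+-suc s i′))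

      neighbours-contiguous : ∀ {v} → (∀ t → v ≢ pos t) → ∀ {a m b} → a < m → m < b → b + 3 ≤ a + L
        → E G v (pos a) → E G v (pos b) → E G v (pos m)
      neighbours-contiguous {v} v∉C {a} {m} {b} a<m m<b b+3≤a+L va vb with E? G v (pos m)
      ... | yes vm = vm
      ... | no ¬vm with lastBelow (λ t → E? G v (pos t)) m a<m va | firstIn (λ t → E? G v (pos t)) m<b vb
      ...   | u , a≤u , u<m , vu , none-after-u | w , m<w , w≤b , vw , none-before-w
        with m≤n⇒∃[o]m+o≡n (≤-trans (<⇒≤ u<m) (<⇒≤ m<w))
      ...     | s , refl = ⊥-elim (<-irrefl refl (≤-trans (+-monoʳ-< s (s≤s (s≤s (s≤s z≤n)))) (≤-trans s+3≤L L≤s+2)))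
        where
        s+3≤L : s + 3 ≤ L
        s+3≤L = +-cancelˡ-≤ a (s + 3) L (≤-trans (≤-reflexive (sym (+-assoc a s 3)))
                  (≤-trans (+-monoˡ-≤ 3 (≤-trans (+-monoˡ-≤ s a≤u) w≤b)) b+3≤a+L))
        2≤s : 2 ≤ s
        2≤s = +-cancelˡ-≤ u 2 s (≤-trans (≤-reflexive (+-comm u 2)) (≤-trans (s≤s u<m) m<w))
        arc-edges : ∀ {i t} → 0 < i → i < 2 → t ≤ s → E G v (pos (u + t)) → (i ≡ 1 × t ≡ s) ⊎ (suc i ≡ 2 × t ≡ 0)
        arc-edges {suc zero} {t} _ _ t≤s e with t ≟ 0 | t ≟ s
        ... | yes t≡0 | _       = inj₂ (refl , t≡0)
        ... | no _    | yes t≡s = inj₁ (refl , t≡s)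
        ... | no t≢0  | no t≢s with <-cmp (u + t) m
        ...   | tri< u+t<m _ _ = ⊥-elim (none-after-u (m<m+n u (n≢0⇒n>0 t≢0)) u+t<m e)
        ...   | tri≈ _ u+t≡m _ = ⊥-elim (¬vm (subst (λ x → E G v (pos x)) u+t≡m e))
        ...   | tri> _ _ m<u+t = ⊥-elim (none-before-w m<u+t (+-monoʳ-< u (≤∧≢⇒< t≤s t≢s)) e)
        arc-edges {suc (suc _)} _ (s≤s (s≤s ())) _ _
        detour : Detour T u s 2 (λ _ → v)
        detour = record
          { offC      = λ _ _ → v∉C
          ; distinct  = λ 0<i i<j j<2 _ → <-irrefl refl (≤-trans j<2 (≤-trans (s≤s 0<i) i<j))
          ; start     = E-sym G vw
          ; step      = λ 0<i 1+i<2 → ⊥-elim (<-irrefl refl (≤-trans 1+i<2 (s≤s 0<i)))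
          ; end       = vu
          ; chordless = λ 0<i 2+i≤j j<2 _ → <-irrefl refl (≤-trans j<2 (≤-trans (m≤m+n 2 _) 2+i≤j))
          ; arc-edges = arc-edges
          }
        L≤s+2 : L ≤ s + 2
        L≤s+2 = detour-length≥L (≤-trans (s≤s z≤n) 2≤s) (≤-trans (+-monoʳ-≤ s (n≤1+n 2)) s+3≤L) ≤-refl
                  (+-monoˡ-≤ 2 2≤s) detour

      -- A non-neighbour has a copy strictly between pos t₁ and pos t₂ on one of the two arcs between
      -- them, contradicting contiguity on that arc.
      neighbours-close : ∀ {v} → (∀ t → v ≢ pos t) → (Σ ℕ λ t → ¬ E G v (pos t))
        → ∀ {t₁ t₂} → t₁ ≤ t₂ → t₂ < t₁ + L → E G v (pos t₁) → E G v (pos t₂)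
        → t₂ ≤ t₁ + 2 ⊎ t₁ + L ≤ t₂ + 2
      neighbours-close {v} v∉C (t₀ , ¬vt₀) {t₁} {t₂} t₁≤t₂ t₂<t₁+L v₁ v₂
        with t₂ ≤? t₁ + 2 | t₁ + L ≤? t₂ + 2
      ... | yes close | _         = inj₁ close
      ... | no _      | yes close = inj₂ close
      ... | no far₁   | no far₂ with periodic-representative T t₀ t₁
      ...   | m , t₁≤m , m<t₁+L , pm≡pt₀ = ⊥-elim (¬vt₀ (subst (E G v) pm≡pt₀ vm))
        where
        vm : E G v (pos m)
        vm with m≤n⇒m<n∨m≡n t₁≤m | <-cmp m t₂
        ... | inj₂ refl | _              = v₁
        ... | inj₁ t₁<m | tri< m<t₂ _ _ =
          neighbours-contiguous v∉C t₁<m m<t₂ (subst (_≤ t₁ + L) (sym (+-suc t₂ 2)) (≰⇒> far₂)) v₁ v₂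
        ... | inj₁ _    | tri≈ _ m≡t₂ _ = subst (λ x → E G v (pos x)) (sym m≡t₂) v₂
        ... | inj₁ _    | tri> _ _ t₂<m =
          neighbours-contiguous v∉C t₂<m m<t₁+L t₁+L+3≤t₂+L v₂ (subst (E G v) (sym (periodic t₁)) v₁)
          where
          t₁+L+3≤t₂+L : t₁ + L + 3 ≤ t₂ + L
          t₁+L+3≤t₂+L = subst (_≤ t₂ + L) (+-swapʳ t₁ 3 L) (+-monoˡ-≤ L (subst (_≤ t₂) (sym (+-suc t₁ 2)) (≰⇒> far₁)))

      -- Walk the arc from α: the first neighbour w of r 1 and the last neighbour u of r (k ∸ 1) before w
      -- are joined through the path, closing a hole of length (w ∸ u) + k unless r (k ∸ 1) sees pos w.
      crossing : ∀ {k r α δ} → InnerPath T k r → 3 ≤ k → δ + 2 ≤ L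
        → E G (r (k ∸ 1)) (pos α) → E G (r 1) (pos (α + δ))
        → ¬ E G (r (k ∸ 1)) (pos (α + δ)) → ¬ E G (r 1) (pos α)
        → (Σ ℕ λ t → α < t × t < α + δ × E G (r 1) (pos t) × E G (r (k ∸ 1)) (pos t)) ⊎ L ≤ δ + k
      crossing {k} {r} {α} {δ} R 3≤k δ+2≤L xα yβ ¬xβ ¬yα
        with firstIn (λ t → E? G (r 1) (pos t)) (m≤m+n α δ) yβ
      ... | w , α≤w , w≤β , yw , y-none-before with m≤n⇒m<n∨m≡n α≤w
      ...   | inj₂ refl = ⊥-elim (¬yα yw)
      ...   | inj₁ α<w with lastBelow (λ t → E? G (r (k ∸ 1)) (pos t)) w α<w xα
      ...     | u , α≤u , u<w , xu , x-none-after with E? G (r (k ∸ 1)) (pos w)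
      ...       | yes xw =
        inj₁ (w , α<w , ≤∧≢⇒< w≤β (λ w≡β → ¬xβ (subst (λ t → E G (r (k ∸ 1)) (pos t)) w≡β xw)) , yw , xw)
      ...       | no ¬xw with m≤n⇒∃[o]m+o≡n (<⇒≤ u<w)
      ...         | s , refl = inj₂ (≤-trans (detour-length≥L 1≤s (≤-trans (+-monoˡ-≤ 2 s≤δ) δ+2≤L) (≤-trans (n≤1+n 2) 3≤k)
                                                (≤-trans (+-monoʳ-≤ 1 3≤k) (+-monoˡ-≤ k 1≤s)) detour)
                                     (+-monoˡ-≤ k s≤δ))
        where
        open InnerPath R
        1≤s : 1 ≤ s
        1≤s = +-cancelˡ-≤ u 1 s (subst (_≤ u + s) (+-comm 1 u) u<w)
        s≤δ : s ≤ δ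
        s≤δ = +-cancelˡ-≤ α s δ (≤-trans (+-monoˡ-≤ s α≤u) w≤β)
        arc-edges : ∀ {i t} → 0 < i → i < k → t ≤ s → E G (r i) (pos (u + t))
                    → (i ≡ 1 × t ≡ s) ⊎ (suc i ≡ k × t ≡ 0)
        arc-edges {i} {t} 0<i i<k t≤s e with i ≟ 1 | suc i ≟ k
        ... | yes refl | _ with t ≟ s
        ...   | yes t≡s = inj₁ (refl , t≡s)
        ...   | no  t≢s = ⊥-elim (y-none-before (≤-trans α≤u (m≤m+n u t)) (+-monoʳ-< u (≤∧≢⇒< t≤s t≢s)) e)
        arc-edges {i} {t} 0<i i<k t≤s e | no i≢1 | yes refl with t ≟ 0 | t ≟ s
        ... | yes t≡0 | _        = inj₂ (refl , t≡0)
        ... | no  _   | yes refl = ⊥-elim (¬xw e)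
        ... | no  t≢0 | no  t≢s  = ⊥-elim (x-none-after (m<m+n u (n≢0⇒n>0 t≢0)) (+-monoʳ-< u (≤∧≢⇒< t≤s t≢s)) e)
        arc-edges {i} {t} 0<i i<k t≤s e | no i≢1 | no 1+i≢k =
          ⊥-elim (quiet (≤∧≢⇒< 0<i (i≢1 ∘ sym)) (≤∧≢⇒< i<k 1+i≢k) (u + t) e)
        detour : Detour T u s k r
        detour = record
          { offC      = offC
          ; distinct  = distinct
          ; start     = E-sym G yw
          ; step      = step
          ; end       = xu
          ; chordless = chordless
          ; arc-edges = arc-edges
          }

      common-neighbour-between : ∀ {k r d} → InnerPath T k r → 3 ≤ k → 2 * d ≤ L → 2 * k < L
        → E G (r 1) (pos 0) → E G (r (k ∸ 1)) (pos d) → ¬ E G (r 1) (pos d) → ¬ E G (r (k ∸ 1)) (pos 0)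
        → Σ ℕ λ z → 0 < z × z < d × E G (r 1) (pos z) × E G (r (k ∸ 1)) (pos z)
      common-neighbour-between {k} {r} {d} R 3≤k 2d≤L 2k<L x0 yd ¬xd ¬y0 =
        conclude (crossing (innerPath-reverse T R) 3≤k (≤-trans (+-monoʳ-≤ d (≤-trans (n≤1+n 2) 3≤k)) (<⇒≤ d+k<L))
                   (subst (λ x → E G x (pos 0)) (sym r[k∸[k∸1]]≡r1) x0) yd
                   (subst (λ x → ¬ E G x (pos d)) (sym r[k∸[k∸1]]≡r1) ¬xd) ¬y0)
        where
        d+k<L : d + k < L
        d+k<L = +-<-halves {d} {k} 2d≤L 2k<L
        r[k∸[k∸1]]≡r1 : r (k ∸ (k ∸ 1)) ≡ r 1
        r[k∸[k∸1]]≡r1 = cong r (m∸[m∸n]≡n (≤-trans (s≤s z≤n) 3≤k))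
        conclude : (Σ ℕ λ z → 0 < z × z < d × E G (r (k ∸ 1)) (pos z) × E G (r (k ∸ (k ∸ 1))) (pos z)) ⊎ L ≤ d + k
                 → Σ ℕ λ z → 0 < z × z < d × E G (r 1) (pos z) × E G (r (k ∸ 1)) (pos z)
        conclude (inj₁ (z , 0<z , z<d , yz , xz)) = z , 0<z , z<d , subst (λ x → E G x (pos z)) r[k∸[k∸1]]≡r1 xz , yz
        conclude (inj₂ L≤d+k) = ⊥-elim (<-irrefl refl (<-≤-trans d+k<L L≤d+k))

      -- A common neighbour z of r 1 and r 2 in (0, d) satisfies z ≤ 2 and d ≤ z + 2.  Crossing the
      -- complementary arc from d to L either closes a hole of length (L ∸ d) + 3, so d ≤ 3, or finds
      -- another common neighbour, which lies too far from z.
      length3-distance≤3 : ∀ {r d} → InnerPath T 3 r → 2 * d ≤ L → 7 ≤ L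
        → E G (r 1) (pos 0) → E G (r 2) (pos d) → ¬ E G (r 1) (pos d) → ¬ E G (r 2) (pos 0) → d ≤ 3
      length3-distance≤3 {r} {d} R 2d≤L 7≤L x0 yd ¬xd ¬y0 with d ≤? 3
      ... | yes d≤3 = d≤3
      ... | no d≰3 with common-neighbour-between R ≤-refl 2d≤L 7≤L x0 yd ¬xd ¬y0
      ...   | z , 0<z , z<d , xz , yz = conclude (crossing R ≤-refl L∸d+2≤L yd x[d+[L∸d]] ¬y[d+[L∸d]] ¬xd)
        where
        open InnerPath R
        4≤d : 4 ≤ d
        4≤d = ≰⇒> d≰3
        d≤L : d ≤ L
        d≤L = ≤-trans (m≤m+n d (d + 0)) 2d≤L
        2≤d : 2 ≤ d
        2≤d = ≤-trans (s≤s (s≤s z≤n)) 4≤d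
        d+2≤L : d + 2 ≤ L
        d+2≤L = ≤-trans (+-monoʳ-≤ d 2≤d) (subst (_≤ L) (cong (d +_) (+-identityʳ d)) 2d≤L)
        close : ∀ {i} → 0 < i → i < 3 → ∀ {t₁ t₂} → t₁ ≤ t₂ → t₂ < t₁ + L
              → E G (r i) (pos t₁) → E G (r i) (pos t₂) → t₂ ≤ t₁ + 2 ⊎ t₁ + L ≤ t₂ + 2
        close 0<i i<3 = neighbours-close (offC 0<i i<3) (offD 0<i i<3)
        z≤2 : z ≤ 2
        z≤2 with close {1} z<s (s≤s (s≤s z≤n)) {0} {z} z≤n (<-≤-trans z<d d≤L) x0 xz
        ... | inj₁ z≤2 = z≤2
        ... | inj₂ L≤z+2 = ⊥-elim (<-irrefl refl (≤-<-trans L≤z+2 (<-≤-trans (+-monoˡ-< 2 z<d) d+2≤L)))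
        d≤z+2 : d ≤ z + 2
        d≤z+2 with close {2} z<s ≤-refl {z} {d} (<⇒≤ z<d) (<-≤-trans (<-≤-trans (m<m+n d z<s) d+2≤L) (m≤n+m L z)) yz yd
        ... | inj₁ d≤z+2 = d≤z+2
        ... | inj₂ z+L≤d+2 = ⊥-elim (<-irrefl refl (<-≤-trans (+-monoˡ-< L 0<z) (≤-trans z+L≤d+2 d+2≤L)))
        L∸d+2≤L : L ∸ d + 2 ≤ L
        L∸d+2≤L = ≤-trans (+-monoʳ-≤ (L ∸ d) 2≤d) (≤-reflexive (m∸n+n≡m d≤L))
        pos[d+[L∸d]]≡pos0 : pos (d + (L ∸ d)) ≡ pos 0
        pos[d+[L∸d]]≡pos0 = trans (cong pos (m+[n∸m]≡n d≤L)) (periodic 0)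
        x[d+[L∸d]] : E G (r 1) (pos (d + (L ∸ d)))
        x[d+[L∸d]] = subst (E G (r 1)) (sym pos[d+[L∸d]]≡pos0) x0
        ¬y[d+[L∸d]] : ¬ E G (r 2) (pos (d + (L ∸ d)))
        ¬y[d+[L∸d]] = ¬y0 ∘ subst (E G (r 2)) pos[d+[L∸d]]≡pos0
        conclude : (Σ ℕ λ t → d < t × t < d + (L ∸ d) × E G (r 1) (pos t) × E G (r 2) (pos t)) ⊎ L ≤ (L ∸ d) + 3
                 → d ≤ 3
        conclude (inj₁ (t , d<t , t<d+[L∸d] , xt , yt))
          with subst (t <_) (m+[n∸m]≡n d≤L) t<d+[L∸d]
        ... | t<L with close {2} z<s ≤-refl {z} {t} (<⇒≤ (<-trans z<d d<t)) (<-≤-trans t<L (m≤n+m L z)) yz yt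
        ...   | inj₁ t≤z+2 = ⊥-elim (<-irrefl refl (<-≤-trans d<t (≤-trans t≤z+2 (≤-trans (+-monoˡ-≤ 2 z≤2) 4≤d))))
        ...   | inj₂ z+L≤t+2 = ⊥-elim (d≰3 (≤-trans d≤z+2 (+-monoˡ-≤ 2 (≤-pred z<2))))
          where
          z<2 : z < 2
          z<2 = +-cancelʳ-< L z 2 (≤-<-trans z+L≤t+2 (subst (t + 2 <_) (+-comm L 2) (+-monoˡ-< 2 t<L)))
        conclude (inj₂ L≤L∸d+3) = +-cancelʳ-≤ (L ∸ d) d 3
          (subst (_≤ 3 + (L ∸ d)) (sym (m+[n∸m]≡n d≤L)) (subst (L ≤_) (+-comm (L ∸ d) 3) L≤L∸d+3))

    common-neighbour⇒distC≤2 : ∀ {v a b} → (∀ e → v ≢ c e) → (Σ (Fin L) λ e → ¬ E G v (c e))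
      → E G v (c a) → E G v (c b) → distC L a b ≤ 2
    common-neighbour⇒distC≤2 {v} {a} {b} v∉C v∉D va vb with orient a b
    ... | pos , T , o with oriented-ends {pos} (E G v) o va vb
    ...   | v0 , vd with neighbours-close T (offC-frame T v∉C) (offD-frame T v∉D) z≤n
                           (half<self (≤-trans (s≤s z≤n) 4≤L) (distC-half a b)) v0 vd
    ...     | inj₁ d≤2   = d≤2
    ...     | inj₂ L≤d+2 = half≤ (distC-half a b) L≤d+2

    chordless-length3-distC≤3 : ∀ {q a b} → VCPath 3 q a b → Chordless 3 q → 7 ≤ L → distC L a b ≤ 3
    chordless-length3-distC≤3 {q} {a} {b} P chordless 7≤L with orient a b
    ... | pos , T , inj₁ (p0 , pd) =
      length3-distance≤3 T (innerPath T P chordless (quiet-length3 {q})) (distC-half a b) 7≤L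
        (subst (E G (q 1)) (sym p0) (second~start P chordless ≤-refl))
        (subst (E G (q 2)) (sym pd) (penultimate~end P chordless ≤-refl))
        (second≁end P chordless ≤-refl ∘ subst (E G (q 1)) pd)
        (penultimate≁start P chordless ≤-refl ∘ subst (E G (q 2)) p0)
    ... | pos , T , inj₂ (p0 , pd) =
      length3-distance≤3 T (innerPath-reverse T (innerPath T P chordless (quiet-length3 {q}))) (distC-half a b) 7≤L
        (subst (E G (q 2)) (sym p0) (penultimate~end P chordless ≤-refl))
        (subst (E G (q 1)) (sym pd) (second~start P chordless ≤-refl))
        (penultimate≁start P chordless ≤-refl ∘ subst (E G (q 2)) pd)
        (second≁end P chordless ≤-refl ∘ subst (E G (q 1)) p0)

    quiet-common-neighbour : ∀ {ℓ q a b} → VCPath ℓ q a b → Chordless ℓ q → Quiet ℓ q → 3 ≤ ℓ → 2 * ℓ < L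
      → Σ (Fin L) λ e → E G (q 1) (c e) × E G (q (ℓ ∸ 1)) (c e)
    quiet-common-neighbour {ℓ} {q} {a} {b} P chordless quiet 3≤ℓ 2ℓ<L with orient a b
    ... | pos , T , inj₁ (p0 , pd) =
      let z , _ , _ , xz , yz = common-neighbour-between T (innerPath T P chordless quiet) 3≤ℓ (distC-half a b) 2ℓ<L
            (subst (E G (q 1)) (sym p0) (second~start P chordless 3≤ℓ))
            (subst (E G (q (ℓ ∸ 1))) (sym pd) (penultimate~end P chordless 3≤ℓ))
            (second≁end P chordless 3≤ℓ ∘ subst (E G (q 1)) pd)
            (penultimate≁start P chordless 3≤ℓ ∘ subst (E G (q (ℓ ∸ 1))) p0)
      in onC-common T xz yz
    ... | pos , T , inj₂ (p0 , pd) =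
      let z , _ , _ , yz , xz = common-neighbour-between T (innerPath-reverse T (innerPath T P chordless quiet)) 3≤ℓ
            (distC-half a b) 2ℓ<L
            (subst (E G (q (ℓ ∸ 1))) (sym p0) (penultimate~end P chordless 3≤ℓ))
            (subst₂ (E G) (sym q[ℓ∸[ℓ∸1]]≡q1) (sym pd) (second~start P chordless 3≤ℓ))
            (penultimate≁start P chordless 3≤ℓ ∘ subst (E G (q (ℓ ∸ 1))) pd)
            (second≁end P chordless 3≤ℓ ∘ subst₂ (E G) q[ℓ∸[ℓ∸1]]≡q1 p0)
      in onC-common T (subst (λ x → E G x (pos z)) q[ℓ∸[ℓ∸1]]≡q1 xz) yz
      where
      q[ℓ∸[ℓ∸1]]≡q1 : q (ℓ ∸ (ℓ ∸ 1)) ≡ q 1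
      q[ℓ∸[ℓ∸1]]≡q1 = cong q (m∸[m∸n]≡n (≤-trans (s≤s z≤n) 3≤ℓ))

    Bounded : ℕ → Set
    Bounded ℓ = ∀ {q a b} → VCPath ℓ q a b → 2 * ℓ < L → distC L a b ≤ pathBound ℓ

    distC-triangle : ∀ a e b → distC L a b ≤ distC L a e + distC L e b
    distC-triangle a e b = cycDist-triangle L (toℕ a) (toℕ e) (toℕ b) (toℕ<n a) (toℕ<n e) (toℕ<n b)

    module _ {ℓ} (IH : ∀ {ℓ′} → ℓ′ < ℓ → Bounded ℓ′) {q a b} (P : VCPath ℓ q a b) (2ℓ<L : 2 * ℓ < L) where
      open VCPath P

      private
        IH′ : ∀ {ℓ′ q′ a′ b′} → ℓ′ < ℓ → VCPath ℓ′ q′ a′ b′ → distC L a′ b′ ≤ pathBound ℓ′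
        IH′ ℓ′<ℓ P′ = IH ℓ′<ℓ P′ (≤-<-trans (*-monoʳ-≤ 2 (<⇒≤ ℓ′<ℓ)) 2ℓ<L)

      distC≤pathBound-chord : Chord ℓ q → distC L a b ≤ pathBound ℓ
      distC≤pathBound-chord (i , j , 2+i≤j , j≤ℓ , chord) with vcPath-shortcut P 2+i≤j j≤ℓ chord
      ... | ℓ′ , ℓ′<ℓ , q′ , P′ = ≤-trans (IH′ ℓ′<ℓ P′) (pathBound-mono (<⇒≤ ℓ′<ℓ))

      distC≤pathBound-noisy : Chordless ℓ q → Noisy ℓ q → distC L a b ≤ pathBound ℓ
      distC≤pathBound-noisy chordless (i , 1<i , 1+i<ℓ , e , qi~e)
        with vcPath-prefix P (<-trans z<s 1<i) (<-trans (n<1+n i) 1+i<ℓ) qi~e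
               (λ e≡q0 → chordless {0} 1<i i≤ℓ (subst (λ v → E G v (q i)) e≡q0 (E-sym G qi~e)))
           | vcPath-prefix (vcPath-reverse P) (m<n⇒0<n∸m i<ℓ) (∸-monoʳ-< (<-trans z<s 1<i) i≤ℓ)
               (subst (λ v → E G v (c e)) (sym (cong q (m∸[m∸n]≡n i≤ℓ))) qi~e)
               (λ e≡qℓ → chordless 1+i<ℓ ≤-refl (subst (E G (q i)) e≡qℓ qi~e))
        where
        i≤ℓ : i ≤ ℓ
        i≤ℓ = <⇒≤ (<-trans (n<1+n i) 1+i<ℓ)
        i<ℓ : i < ℓ
        i<ℓ = <-trans (n<1+n i) 1+i<ℓ
      ... | _ , P₁ | _ , P₂ = begin
        distC L a b                                  ≤⟨ distC-triangle a e b ⟩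
        distC L a e + distC L e b                    ≡⟨ cong (distC L a e +_) (cycDist-comm L (toℕ e) (toℕ b)) ⟩
        distC L a e + distC L b e                    ≤⟨ +-mono-≤ (IH′ 1+i<ℓ P₁) (IH′ 1+ℓ∸i<ℓ P₂) ⟩
        pathBound (suc i) + pathBound (suc (ℓ ∸ i))  ≤⟨ pathBound-split 1<i (m+n≤o⇒m≤o∸n 2 1+i<ℓ) ⟩
        pathBound (i + (ℓ ∸ i))                      ≡⟨ cong pathBound (m+[n∸m]≡n (<⇒≤ (<-trans (n<1+n i) 1+i<ℓ))) ⟩
        pathBound ℓ                                  ∎
        where
        open ≤-Reasoning
        1+ℓ∸i<ℓ : suc (ℓ ∸ i) < ℓ
        1+ℓ∸i<ℓ = ∸-gap {0} 1<i (<⇒≤ (<-trans (n<1+n i) 1+i<ℓ))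

      distC≤pathBound-quiet : Chordless ℓ q → Quiet ℓ q → 3 ≤ ℓ → distC L a b ≤ pathBound ℓ
      distC≤pathBound-quiet chordless quiet 3≤ℓ with m≤n⇒m<n∨m≡n 3≤ℓ
      ... | inj₂ refl = chordless-length3-distC≤3 P chordless 2ℓ<L
      ... | inj₁ 4≤ℓ with quiet-common-neighbour P chordless quiet 3≤ℓ 2ℓ<L
      ...   | e , second~e , penultimate~e = begin
        distC L a b                ≤⟨ distC-triangle a e b ⟩
        distC L a e + distC L e b  ≤⟨ +-mono-≤ a~e b~e ⟩
        4                          ≤⟨ s≤s (s≤s (s≤s (s≤s z≤n))) ⟩
        pathBound 4                ≤⟨ pathBound-mono 4≤ℓ ⟩
        pathBound ℓ                ∎
        where
        open ≤-Reasoning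
        1<ℓ : 1 < ℓ
        1<ℓ = ≤-trans (s≤s (s≤s z≤n)) 3≤ℓ
        0<ℓ∸1 : 0 < ℓ ∸ 1
        0<ℓ∸1 = m<n⇒0<n∸m 1<ℓ
        ℓ∸1<ℓ : ℓ ∸ 1 < ℓ
        ℓ∸1<ℓ = ∸-monoʳ-< z<s (<⇒≤ 1<ℓ)
        a~e : distC L a e ≤ 2
        a~e = common-neighbour⇒distC≤2 (offC z<s 1<ℓ) (offD z<s 1<ℓ) (second~start P chordless 3≤ℓ) second~e
        b~e : distC L e b ≤ 2
        b~e = common-neighbour⇒distC≤2 (offC 0<ℓ∸1 ℓ∸1<ℓ) (offD 0<ℓ∸1 ℓ∸1<ℓ) penultimate~e (penultimate~end P chordless 3≤ℓ)

      distC≤pathBound-chordless : Chordless ℓ q → 2 ≤ ℓ → distC L a b ≤ pathBound ℓ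
      distC≤pathBound-chordless chordless 2≤ℓ with m≤n⇒m<n∨m≡n 2≤ℓ | noisy-or-quiet ℓ q
      ... | inj₂ refl | _ = common-neighbour⇒distC≤2 (offC z<s ≤-refl) (offD z<s ≤-refl)
                              (subst (E G (q 1)) start (E-sym G (adjacent z<s))) (subst (E G (q 1)) end (adjacent ≤-refl))
      ... | inj₁ 3≤ℓ | inj₁ noisy = distC≤pathBound-noisy chordless noisy
      ... | inj₁ 3≤ℓ | inj₂ quiet = distC≤pathBound-quiet chordless quiet 3≤ℓ

    distC≤pathBound : ∀ ℓ → Bounded ℓ
    distC≤pathBound = <-rec Bounded step
      where
      step : ∀ ℓ → (∀ {ℓ′} → ℓ′ < ℓ → Bounded ℓ′) → Bounded ℓ
      step 0 _ {a = a} P _ with c-injective (trans (sym (VCPath.start P)) (VCPath.end P))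
      ... | refl = ≤-reflexive (cycDist-refl L (toℕ a))
      step 1 _ {a = a} {b} P _ =
        ≤-reflexive (proj₁ (c-adjacent a b) (subst₂ (E G) (VCPath.start P) (VCPath.end P) (VCPath.adjacent P z<s)))
      step (suc (suc ℓ)) IH {q} P 2ℓ<L with chord-or-chordless (2 + ℓ) q
      ... | inj₁ chord     = distC≤pathBound-chord IH P 2ℓ<L chord
      ... | inj₂ chordless = distC≤pathBound-chordless IH P 2ℓ<L chordless (s≤s (s≤s z≤n))

lemma4p3 : (G : Graph) (k : ℕ) → 1 ≤ k
    → (L : ℕ) (c : Fin L → Fin (Graph.n G))
    → IsShortestHole G L c → GreaterThanMu k L → ChordalMinusCycle G L c
    → (m : ℕ) → 1 ≤ m
    → (ℓ : ℕ) (p : Fin (suc ℓ) → Fin (Graph.n G))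
    → IsVCPathInGminusD G L c ℓ p
    → (a b : Fin L) → c a ≡ p fzero → c b ≡ p (fromℕ ℓ)
    → ℓ ≤ m + 2
    → distC L a b ≤ 4 * m ∸ 1
lemma4p3 G _ _ L c (hole , shortest) _ _ m 1≤m ℓ p path a b ca cb ℓ≤m+2 = bound (2 * ℓ <? L)
  where
  open Cycle G L c hole
  open ≤-Reasoning
  bound : Dec (2 * ℓ < L) → distC L a b ≤ 4 * m ∸ 1
  bound (yes 2ℓ<L) = begin
    distC L a b        ≤⟨ Shortest.distC≤pathBound shortest ℓ (vcPath-fromFin path ca cb) 2ℓ<L ⟩
    pathBound ℓ        ≤⟨ pathBound-mono ℓ≤m+2 ⟩
    pathBound (m + 2)  ≡⟨ pathBound[m+2] m 1≤m ⟩
    4 * m ∸ 1          ∎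
  bound (no 2ℓ≮L) = begin
    distC L a b  ≤⟨ *-cancelˡ-≤ 2 (≤-trans (distC-half a b) (≮⇒≥ 2ℓ≮L)) ⟩
    ℓ            ≤⟨ ℓ≤m+2 ⟩
    m + 2        ≤⟨ m+2≤4m∸1 m 1≤m ⟩
    4 * m ∸ 1    ∎
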